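{- Let $q$ be a prime power, let $F$ be a field containing $\mathbb{F}_q$, let $d\ge 1$ and $1\le s<q$ be integers, and let $\mu, b_1,\dots,b_d\in F$, $M_j\in F$ ($1\le j\le s$) and $B_{ij}\in F$ ($1\le i\le d$, $1\le j\le s$). Assume $\mu+\sum_{i=1}^d\theta_ib_i\neq 0$ for all $\theta=(\theta_1,\dots,\theta_d)\in\mathbb{F}_q^d$. Then $$\prod_{j=1}^s\ \sum_{\theta\in \mathbb{F}_q^d}\frac{M_j+\sum_{i=1}^d \theta_iB_{ij}}{\mu+\sum_{i=1}^d\theta_ib_i} =\Big(\sum_{\theta\in\mathbb{F}_q^d} \frac{1}{\mu+\sum_{i=1}^d\theta_ib_i}\Big)^{s-1} \sum_{\theta\in\mathbb{F}_q^d} \frac{\prod_{j=1}^s \big(M_j+\sum_{i=1}^d\theta_iB_{ij}\big)}{\mu+\sum_{i=1}^d \theta_ib_i}.$$ -}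

module Defs where

open import Level using (Level; _⊔_; suc)
open import Algebra.Bundles using (CommutativeRing)
open import Data.Nat as ℕ using (ℕ; zero; suc; _≥_)
open import Data.Nat.Primality using (Prime)
open import Data.Fin using (Fin)
open import Data.Vec using (Vec; []; _∷_)
open import Data.List using (List; []; _∷_; map; concatMap; foldr; allFin)
open import Data.Product using (Σ; ∃; _×_; _,_)
open import Relation.Nullary using (¬_)
open import Relation.Binary.PropositionalEquality using (_≡_)

IsPrimePower : ℕ → Set
IsPrimePower q = ∃ λ p → ∃ λ k → Prime p × k ≥ 1 × q ≡ p ℕ.^ k

record Field (c ℓ : Level) : Set (Level.suc (c ⊔ ℓ)) where
  field
    commRing : CommutativeRing c ℓ
  open CommutativeRing commRing public
  field
    0≉1   : ¬ (0# ≈ 1#)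
    inv   : (x : Carrier) → ¬ (x ≈ 0#) → Carrier
    inv-r : (x : Carrier) (x≉0 : ¬ (x ≈ 0#)) → x * inv x x≉0 ≈ 1#

module _ {c ℓ} (F : Field c ℓ) where
  open Field F

  ΣL : List Carrier → Carrier
  ΣL = foldr _+_ 0#

  ΠL : List Carrier → Carrier
  ΠL = foldr _*_ 1#

  pow : Carrier → ℕ → Carrier
  pow x zero = 1#
  pow x (suc n) = x * pow x n

  -- A subfield of F with exactly q elements, given by an injective
  -- enumeration e : Fin q → F whose image contains 0, 1 and is closed
  -- under +, *, negation and inverses of nonzero elements.
  record FiniteSubfield (q : ℕ) : Set (c ⊔ ℓ) where
    field
      e      : Fin q → Carrier
      e-inj  : ∀ a b → e a ≈ e b → a ≡ b
      has-0  : ∃ λ a → e a ≈ 0#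
      has-1  : ∃ λ a → e a ≈ 1#
      +-cl   : ∀ a b → ∃ λ r → e r ≈ e a + e b
      *-cl   : ∀ a b → ∃ λ r → e r ≈ e a * e b
      neg-cl : ∀ a → ∃ λ r → e r ≈ - e a
      inv-cl : ∀ a (nz : ¬ (e a ≈ 0#)) → ∃ λ r → e r ≈ inv (e a) nz

allVecs : (q d : ℕ) → List (Vec (Fin q) d)
allVecs q zero = [] ∷ []
allVecs q (suc d) = concatMap (λ a → map (a ∷_) (allVecs q d)) (allFin q)

-- For one variable, the sum φ(g) = Σ_{a ∈ F_q} g(a) / (m + a β) is governed by the
-- vanishing of the power sums Σ_a a^k (k < q − 1): it gives m φ(a^k) = −β φ(a^{k+1}),
-- and hence, for affine forms α_j + a γ_j and s ≤ q − 1,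
--   φ(∏_j (α_j + a γ_j)) · N = −(−β)^{q−1−s} ∏_j (γ_j m − α_j β),  N = m^q − m (−β)^{q−1}.
-- Summing out the first coordinate of θ therefore turns ∏_j L_j(θ) / den(θ) into a
-- product of s affine forms in the remaining coordinates over N, and N is again affine
-- in them because x ↦ x^q is additive and fixes F_q. By induction on d,
--   Σ_θ ∏_{j ≤ s} L_j(θ) / den(θ) = κ w^{q−1−s} ∏_j L̂_j(w, u),
-- where κ, w, u depend on den only and L̂ is the homogenisation of L; both sides of
-- the theorem then equal κ^s w^{s(q−2)} ∏_j L̂_j(w, u).

module Submission where

open import Defs
open import Data.Nat using (ℕ; _≥_; _<_; _∸_)
open import Data.Fin using (Fin)
open import Data.Vec using (Vec; lookup)
open import Data.List using (map; allFin)
open import Relation.Nullary using (¬_)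

open import Level using (_⊔_)
open import Algebra.Bundles using (CommutativeMonoid; CommutativeRing; RawRing)
import Algebra.Solver.Ring
import Algebra.Solver.Ring.AlmostCommutativeRing as ACR
import Tactic.RingSolver.Core.AlmostCommutativeRing as TACR
import Tactic.RingSolver.NonReflective as NonReflective
open import Data.Empty using (⊥-elim)
open import Data.Fin as Fin using (zero; suc; punchIn; inject₁; fromℕ)
import Data.Fin.Properties as Fin
open import Data.Fin.Permutation using (permutation)
open import Data.List using (List; []; _∷_; foldr; _++_; concatMap; length)
import Data.List.Properties as List
open import Data.Maybe using (Maybe; just; nothing)
import Data.Nat as ℕ
import Data.Nat.Properties as ℕ
open import Data.Nat.Combinatorics using (_C_; nCn≡1)
open import Data.Nat.Divisibility using (quotient; m∣n⇒n≡quotient*m)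
open import Data.Nat.Primality using (Prime)
open import Data.Product using (∃; _,_; proj₁; proj₂)
import Data.Product as Prod
open import Data.Sum using (_⊎_; inj₁; inj₂)
open import Data.Vec using ([]; _∷_)
open import Function using (_∘_; id)
open import Relation.Nullary using (yes; no)
open import Relation.Nullary.Negation using (contradiction)
open import Relation.Binary.PropositionalEquality as ≡ using (_≡_; _≢_)

module Arithmetic where
  open import Data.Nat
  open import Data.Nat.Properties
  open import Data.Nat.Divisibility
  open import Data.Nat.Combinatorics
  open import Data.Nat.DivMod using (m/n*n≡m)
  open import Data.Nat.Primality
  open import Relation.Binary.PropositionalEquality

  prime⇒2≤ : ∀ {p} → Prime p → 2 ≤ p
  prime⇒2≤ {p} pp = nonTrivial⇒n>1 p {{prime⇒nonTrivial pp}}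

  prime∤! : ∀ {p} → Prime p → ∀ {m} → m < p → ¬ p ∣ m !
  prime∤! pp {zero}  _   p∣1 = <⇒≢ (prime⇒2≤ pp) (sym (∣1⇒≡1 p∣1))
  prime∤! pp {suc m} m<p p∣m! with euclidsLemma (suc m) (m !) pp p∣m!
  ... | inj₁ p∣1+m = <⇒≱ m<p (∣⇒≤ p∣1+m)
  ... | inj₂ p∣m!  = prime∤! pp (<-pred (m<n⇒m<1+n m<p)) p∣m!

  nCk*k![n∸k]!≡n! : ∀ {n k} → k ≤ n → (n C k) * (k ! * (n ∸ k) !) ≡ n !
  nCk*k![n∸k]!≡n! {n} {k} k≤n = trans (cong (_* (k ! * (n ∸ k) !)) (nCk≡n!/k![n-k]! k≤n))
                                     (m/n*n≡m {{k !* (n ∸ k) !≢0}} (k![n∸k]!∣n! k≤n))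

  prime∣binomial : ∀ {p k} → Prime p → 0 < k → k < p → p ∣ p C k
  prime∣binomial {p@(suc p′)} {k} pp 0<k k<p
    with euclidsLemma (p C k) (k ! * (p ∸ k) !) pp (subst (p ∣_) (sym (nCk*k![n∸k]!≡n! (<⇒≤ k<p))) (m∣m*n (p′ !)))
  ... | inj₁ p∣pCk = p∣pCk
  ... | inj₂ p∣k![p∸k]! with euclidsLemma (k !) ((p ∸ k) !) pp p∣k![p∸k]!
  ...   | inj₁ p∣k!     = contradiction p∣k! (prime∤! pp k<p)
  ...   | inj₂ p∣[p∸k]! = contradiction p∣[p∸k]! (prime∤! pp (∸-monoʳ-< 0<k (<⇒≤ k<p)))

  [m+n]*[1+m]≡[1+m+n]*m+n : ∀ m n → (m + n) * suc m ≡ suc (m + n) * m + n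
  [m+n]*[1+m]≡[1+m+n]*m+n = solve 2 (λ m n → (m :+ n) :* (con 1 :+ m) := (con 1 :+ m :+ n) :* m :+ n) refl
    where open import Data.Nat.Solver using (module +-*-Solver)
          open +-*-Solver

open Arithmetic

module CommutativeRingSolver {c ℓ} (R : CommutativeRing c ℓ) where
  open CommutativeRing R
  open import Relation.Binary.Reasoning.Setoid setoid
  open import Algebra.Properties.Semiring.Mult semiring using (_×_; ×1-homo-*; ×-homo-+)
  open import Algebra.Properties.Ring ring using (-0#≈0#; -‿involutive; -‿distribʳ-*; x[y-z]≈xy-xz; [y-z]x≈yx-zx)
  open import Algebra.Properties.AbelianGroup +-abelianGroup using (⁻¹-∙-comm)

  private
    -- Its normal forms keep coefficients in the carrier, where 1# + - 1# does not
    -- reduce, so it only proves identities needing no coefficient arithmetic.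
    open NonReflective (TACR.fromCommutativeRing R (λ _ → nothing))
      using (_⊕_; _⊗_; ⊝_; _⊜_) renaming (solve to solve₀)

    -- Integer coefficients as formal differences (a , b) ↦ a − b, which do compute.
    Diff : RawRing _ _
    Diff = record
      { Carrier = ℕ Prod.× ℕ
      ; _≈_ = _≡_
      ; _+_ = λ { (a , b) (a′ , b′) → (a ℕ.+ a′ , b ℕ.+ b′) }
      ; _*_ = λ { (a , b) (a′ , b′) → (a ℕ.* a′ ℕ.+ b ℕ.* b′ , a ℕ.* b′ ℕ.+ b ℕ.* a′) }
      ; -_ = λ { (a , b) → (b , a) }
      ; 0# = (0 , 0)
      ; 1# = (1 , 0)
      }

    ⟦_⟧ : ℕ Prod.× ℕ → Carrier
    ⟦ a , b ⟧ = a × 1# - b × 1#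

    +-homo : ∀ a b a′ b′ → ⟦ a ℕ.+ a′ , b ℕ.+ b′ ⟧ ≈ ⟦ a , b ⟧ + ⟦ a′ , b′ ⟧
    +-homo a b a′ b′ = begin
      (a ℕ.+ a′) × 1# - (b ℕ.+ b′) × 1#             ≈⟨ +-cong (×-homo-+ 1# a a′) (-‿cong (×-homo-+ 1# b b′)) ⟩
      (a × 1# + a′ × 1#) - (b × 1# + b′ × 1#)       ≈⟨ solve₀ 4 (λ x x′ y y′ → ((x ⊕ x′) ⊕ ⊝ (y ⊕ y′)) ⊜ ((x ⊕ ⊝ y) ⊕ (x′ ⊕ ⊝ y′))) refl _ _ _ _ ⟩
      (a × 1# - b × 1#) + (a′ × 1# - b′ × 1#)       ∎

    -[x-y]≈y-x : ∀ x y → - (x - y) ≈ y - x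
    -[x-y]≈y-x x y = begin
      - (x - y)    ≈⟨ ⁻¹-∙-comm x (- y) ⟨
      - x + - - y  ≈⟨ +-congˡ (-‿involutive y) ⟩
      - x + y      ≈⟨ +-comm (- x) y ⟩
      y - x        ∎

    *-homo : ∀ a b a′ b′ → ⟦ a ℕ.* a′ ℕ.+ b ℕ.* b′ , a ℕ.* b′ ℕ.+ b ℕ.* a′ ⟧ ≈ ⟦ a , b ⟧ * ⟦ a′ , b′ ⟧
    *-homo a b a′ b′ = begin
      (a ℕ.* a′ ℕ.+ b ℕ.* b′) × 1# - (a ℕ.* b′ ℕ.+ b ℕ.* a′) × 1#
        ≈⟨ +-cong (trans (×-homo-+ 1# (a ℕ.* a′) _) (+-cong (×1-homo-* a a′) (×1-homo-* b b′)))
                  (-‿cong (trans (×-homo-+ 1# (a ℕ.* b′) _) (+-cong (×1-homo-* a b′) (×1-homo-* b a′)))) ⟩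
      (x * x′ + y * y′) - (x * y′ + y * x′)
        ≈⟨ solve₀ 4 (λ x y x′ y′ → ((x ⊕ y) ⊕ ⊝ (x′ ⊕ y′)) ⊜ ((x ⊕ ⊝ x′) ⊕ (y ⊕ ⊝ y′))) refl (x * x′) (y * y′) (x * y′) (y * x′) ⟩
      (x * x′ - x * y′) + (y * y′ - y * x′)  ≈⟨ +-cong (x[y-z]≈xy-xz x x′ y′) (x[y-z]≈xy-xz y y′ x′) ⟨
      x * (x′ - y′) + y * (y′ - x′)          ≈⟨ +-congˡ (*-congˡ (-[x-y]≈y-x x′ y′)) ⟨
      x * (x′ - y′) + y * - (x′ - y′)        ≈⟨ +-congˡ (-‿distribʳ-* y _) ⟨
      x * (x′ - y′) + - (y * (x′ - y′))      ≈⟨ [y-z]x≈yx-zx (x′ - y′) x y ⟨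
      (x - y) * (x′ - y′)                    ∎
      where
      x = a × 1#
      y = b × 1#
      x′ = a′ × 1#
      y′ = b′ × 1#

    homomorphism : Diff ACR.-Raw-AlmostCommutative⟶ ACR.fromCommutativeRing R
    homomorphism = record
      { ⟦_⟧ = ⟦_⟧
      ; +-homo = λ { (a , b) (a′ , b′) → +-homo a b a′ b′ }
      ; *-homo = λ { (a , b) (a′ , b′) → *-homo a b a′ b′ }
      ; -‿homo = λ { (a , b) → sym (-[x-y]≈y-x (a × 1#) (b × 1#)) }
      ; 0-homo = -‿inverseʳ 0#
      ; 1-homo = trans (+-cong (+-identityʳ 1#) -0#≈0#) (+-identityʳ 1#)
      }

    x-y≈[x+z]-[y+z] : ∀ x y z → x - y ≈ (x + z) - (y + z)
    x-y≈[x+z]-[y+z] x y z = begin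
      x - y                  ≈⟨ +-identityʳ (x - y) ⟨
      (x - y) + 0#           ≈⟨ +-congˡ (-‿inverseʳ z) ⟨
      (x - y) + (z - z)      ≈⟨ solve₀ 4 (λ x y z z′ → ((x ⊕ ⊝ y) ⊕ (z ⊕ ⊝ z′)) ⊜ ((x ⊕ z) ⊕ ⊝ (y ⊕ z′))) refl x y z z ⟩
      (x + z) - (y + z)      ∎

    ≈-from-cross : ∀ {x y x′ y′} → x + y′ ≈ x′ + y → x - y ≈ x′ - y′
    ≈-from-cross {x} {y} {x′} {y′} e = begin
      x - y                  ≈⟨ x-y≈[x+z]-[y+z] x y y′ ⟩
      (x + y′) - (y + y′)    ≈⟨ +-cong e (-‿cong (+-comm y y′)) ⟩
      (x′ + y) - (y′ + y)    ≈⟨ x-y≈[x+z]-[y+z] x′ y′ y ⟨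
      x′ - y′                ∎

    _≟-diff_ : ∀ u v → Maybe (⟦ u ⟧ ≈ ⟦ v ⟧)
    (a , b) ≟-diff (a′ , b′) with a ℕ.+ b′ ℕ.≟ a′ ℕ.+ b
    ... | no _  = nothing
    ... | yes e = just (≈-from-cross (begin
      a × 1# + b′ × 1#   ≈⟨ ×-homo-+ 1# a b′ ⟨
      (a ℕ.+ b′) × 1#    ≡⟨ ≡.cong (_× 1#) e ⟩
      (a′ ℕ.+ b) × 1#    ≈⟨ ×-homo-+ 1# a′ b ⟩
      a′ × 1# + b × 1#   ∎))

  open Algebra.Solver.Ring Diff (ACR.fromCommutativeRing R) homomorphism _≟-diff_ public
    using (solve; _:=_; _:+_; _:*_; _:-_; :-_)

map-allFin-suc : ∀ {a} {A : Set a} {n} (f : Fin (ℕ.suc n) → A) → map f (allFin (ℕ.suc n)) ≡ f zero ∷ map (f ∘ suc) (allFin n)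
map-allFin-suc f = ≡.cong (f zero ∷_) (≡.trans (List.map-tabulate suc f) (≡.sym (List.map-tabulate id (f ∘ suc))))

module ListFold {c ℓ} (M : CommutativeMonoid c ℓ) where
  open CommutativeMonoid M
  open import Relation.Binary.Reasoning.Setoid setoid
  open import Algebra.Properties.CommutativeMonoid.Sum M using (sum; sum-permute; sum-remove)
  open import Algebra.Properties.Monoid.Mult monoid using (_×_)

  ⨁ : List Carrier → Carrier
  ⨁ = foldr _∙_ ε

  module _ {a} {A : Set a} where

    ⨁-cong : {f g : A → Carrier} (xs : List A) → (∀ x → f x ≈ g x) → ⨁ (map f xs) ≈ ⨁ (map g xs)
    ⨁-cong []       f≈g = refl
    ⨁-cong (x ∷ xs) f≈g = ∙-cong (f≈g x) (⨁-cong xs f≈g)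

    ⨁-ε : (f : A → Carrier) (xs : List A) → (∀ x → f x ≈ ε) → ⨁ (map f xs) ≈ ε
    ⨁-ε f []       f≈ε = refl
    ⨁-ε f (x ∷ xs) f≈ε = trans (∙-cong (f≈ε x) (⨁-ε f xs f≈ε)) (identityˡ ε)

    ⨁-const : (y : Carrier) (xs : List A) → ⨁ (map (λ _ → y) xs) ≈ length xs × y
    ⨁-const y []       = refl
    ⨁-const y (x ∷ xs) = ∙-congˡ (⨁-const y xs)

    ⨁-distrib : (f g : A → Carrier) (xs : List A) →
                ⨁ (map (λ x → f x ∙ g x) xs) ≈ ⨁ (map f xs) ∙ ⨁ (map g xs)
    ⨁-distrib f g []       = sym (identityˡ ε)
    ⨁-distrib f g (x ∷ xs) = begin
      (f x ∙ g x) ∙ ⨁ (map (λ x → f x ∙ g x) xs)    ≈⟨ ∙-congˡ (⨁-distrib f g xs) ⟩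
      (f x ∙ g x) ∙ (⨁ (map f xs) ∙ ⨁ (map g xs))   ≈⟨ interchange (f x) (g x) _ _ ⟩
      (f x ∙ ⨁ (map f xs)) ∙ (g x ∙ ⨁ (map g xs))   ∎
      where open import Algebra.Properties.CommutativeSemigroup commutativeSemigroup using (interchange)

  ⨁-++ : (xs ys : List Carrier) → ⨁ (xs ++ ys) ≈ ⨁ xs ∙ ⨁ ys
  ⨁-++ []       ys = sym (identityˡ (⨁ ys))
  ⨁-++ (x ∷ xs) ys = trans (∙-congˡ (⨁-++ xs ys)) (sym (assoc x (⨁ xs) (⨁ ys)))

  module _ {a b} {A : Set a} {B : Set b} where

    ⨁-concatMap : (f : B → Carrier) (g : A → List B) (xs : List A) →
                  ⨁ (map f (concatMap g xs)) ≈ ⨁ (map (λ x → ⨁ (map f (g x))) xs)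
    ⨁-concatMap f g []       = refl
    ⨁-concatMap f g (x ∷ xs) = begin
      ⨁ (map f (g x ++ concatMap g xs))                  ≡⟨ ≡.cong ⨁ (List.map-++ f (g x) (concatMap g xs)) ⟩
      ⨁ (map f (g x) ++ map f (concatMap g xs))          ≈⟨ ⨁-++ (map f (g x)) _ ⟩
      ⨁ (map f (g x)) ∙ ⨁ (map f (concatMap g xs))      ≈⟨ ∙-congˡ (⨁-concatMap f g xs) ⟩
      ⨁ (map f (g x)) ∙ ⨁ (map (λ x → ⨁ (map f (g x))) xs) ∎

    ⨁-comm : (f : A → B → Carrier) (xs : List A) (ys : List B) →
             ⨁ (map (λ x → ⨁ (map (f x) ys)) xs) ≈ ⨁ (map (λ y → ⨁ (map (λ x → f x y) xs)) ys)
    ⨁-comm f []       ys = sym (⨁-ε (λ _ → ε) ys (λ _ → refl))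
    ⨁-comm f (x ∷ xs) ys = begin
      ⨁ (map (f x) ys) ∙ ⨁ (map (λ x → ⨁ (map (f x) ys)) xs)          ≈⟨ ∙-congˡ (⨁-comm f xs ys) ⟩
      ⨁ (map (f x) ys) ∙ ⨁ (map (λ y → ⨁ (map (λ x → f x y) xs)) ys)  ≈⟨ ⨁-distrib (f x) _ ys ⟨
      ⨁ (map (λ y → f x y ∙ ⨁ (map (λ x → f x y) xs)) ys)             ∎

  ⨁-allFin : ∀ {n} (f : Fin n → Carrier) → ⨁ (map f (allFin n)) ≡ sum f
  ⨁-allFin {ℕ.zero}  f = ≡.refl
  ⨁-allFin {ℕ.suc n} f = ≡.trans (≡.cong ⨁ (map-allFin-suc f)) (≡.cong (f zero ∙_) (⨁-allFin (f ∘ suc)))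

  ⨁-permute : ∀ {n} (σ τ : Fin n → Fin n) → (∀ i → σ (τ i) ≡ i) → (∀ i → τ (σ i) ≡ i) →
              (f : Fin n → Carrier) → ⨁ (map (f ∘ σ) (allFin n)) ≈ ⨁ (map f (allFin n))
  ⨁-permute {n} σ τ στ τσ f = begin
    ⨁ (map (f ∘ σ) (allFin n))  ≡⟨ ⨁-allFin (f ∘ σ) ⟩
    sum (f ∘ σ)                 ≈⟨ sum-permute f (permutation σ τ στ τσ) ⟨
    sum f                       ≡⟨ ⨁-allFin f ⟨
    ⨁ (map f (allFin n))        ∎

  ⨁-remove : ∀ {n} (i : Fin (ℕ.suc n)) (f : Fin (ℕ.suc n) → Carrier) →
             ⨁ (map f (allFin (ℕ.suc n))) ≈ f i ∙ ⨁ (map (f ∘ punchIn i) (allFin n))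
  ⨁-remove {n} i f = begin
    ⨁ (map f (allFin (ℕ.suc n)))              ≡⟨ ⨁-allFin f ⟩
    sum f                                     ≈⟨ sum-remove {i = i} f ⟩
    f i ∙ sum (f ∘ punchIn i)                 ≡⟨ ≡.cong (f i ∙_) (⨁-allFin (f ∘ punchIn i)) ⟨
    f i ∙ ⨁ (map (f ∘ punchIn i) (allFin n))  ∎

module FieldTheory {c ℓ} (F : Field c ℓ) where
  open Field F hiding (zero)
  open import Relation.Binary.Reasoning.Setoid setoid
  open CommutativeRingSolver commRing
  open import Algebra.Properties.Ring ring using (-0#≈0#)
  open import Algebra.Properties.Semiring.Exp semiring public using (_^_; ^-homo-*; ^-assocʳ; ^-congˡ)
  open import Algebra.Properties.CommutativeSemiring.Exp commutativeSemiring public using (^-distrib-*)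
  open import Algebra.Properties.Semiring.Mult semiring public using (_×_; ×1-homo-*; ×-assoc-*)
  import Algebra.Properties.Monoid.Mult +-monoid as Mult
  open ListFold +-commutativeMonoid public using ()
    renaming (⨁-cong to ∑-cong; ⨁-const to ∑-const; ⨁-distrib to ∑-+; ⨁-concatMap to ∑-concatMap;
              ⨁-comm to ∑-comm; ⨁-permute to ∑-permute; ⨁-remove to ∑-remove)
  open ListFold *-commutativeMonoid public using ()
    renaming (⨁-cong to ∏-cong; ⨁-const to ∏-const; ⨁-distrib to ∏-*; ⨁-permute to ∏-permute; ⨁-remove to ∏-remove)

  ∑ ∏ : List Carrier → Carrier
  ∑ = ΣL F
  ∏ = ΠL F

  module _ {a} {A : Set a} where

    ∑-*ˡ : (k : Carrier) (f : A → Carrier) (xs : List A) → ∑ (map (λ x → k * f x) xs) ≈ k * ∑ (map f xs)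
    ∑-*ˡ k f []       = sym (zeroʳ k)
    ∑-*ˡ k f (x ∷ xs) = trans (+-congˡ (∑-*ˡ k f xs)) (sym (distribˡ k _ _))

    ∑-neg : (f : A → Carrier) (xs : List A) → ∑ (map (λ x → - f x) xs) ≈ - ∑ (map f xs)
    ∑-neg f []       = sym -0#≈0#
    ∑-neg f (x ∷ xs) = trans (+-congˡ (∑-neg f xs)) (⁻¹-∙-comm (f x) _)
      where open import Algebra.Properties.AbelianGroup +-abelianGroup using (⁻¹-∙-comm)

  inv-cong : ∀ {x y} (x≉0 : ¬ x ≈ 0#) (y≉0 : ¬ y ≈ 0#) → x ≈ y → inv x x≉0 ≈ inv y y≉0
  inv-cong {x} {y} x≉0 y≉0 x≈y = begin
    inv x x≉0                      ≈⟨ *-identityʳ _ ⟨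
    inv x x≉0 * 1#                 ≈⟨ *-congˡ (inv-r y y≉0) ⟨
    inv x x≉0 * (y * inv y y≉0)    ≈⟨ solve 3 (λ a y b → a :* (y :* b) := (y :* a) :* b) refl _ y _ ⟩
    (y * inv x x≉0) * inv y y≉0    ≈⟨ *-congʳ (*-congʳ x≈y) ⟨
    (x * inv x x≉0) * inv y y≉0    ≈⟨ *-congʳ (inv-r x x≉0) ⟩
    1# * inv y y≉0                 ≈⟨ *-identityˡ _ ⟩
    inv y y≉0                      ∎

  *≈⇒≈*inv : ∀ {t x r} (x≉0 : ¬ x ≈ 0#) → t * x ≈ r → t ≈ r * inv x x≉0
  *≈⇒≈*inv {t} {x} {r} x≉0 tx≈r = begin
    t                     ≈⟨ *-identityʳ t ⟨
    t * 1#                ≈⟨ *-congˡ (inv-r x x≉0) ⟨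
    t * (x * inv x x≉0)   ≈⟨ *-assoc t x _ ⟨
    (t * x) * inv x x≉0   ≈⟨ *-congʳ tx≈r ⟩
    r * inv x x≉0         ∎

  *-cancelʳ : ∀ {a b x} → ¬ x ≈ 0# → a * x ≈ b * x → a ≈ b
  *-cancelʳ {a} {b} {x} x≉0 ax≈bx = begin
    a                    ≈⟨ *≈⇒≈*inv x≉0 ax≈bx ⟩
    (b * x) * inv x x≉0  ≈⟨ *-assoc b x _ ⟩
    b * (x * inv x x≉0)  ≈⟨ *-congˡ (inv-r x x≉0) ⟩
    b * 1#               ≈⟨ *-identityʳ b ⟩
    b                    ∎

  *-nonzero : ∀ {x y} → ¬ x ≈ 0# → ¬ y ≈ 0# → ¬ x * y ≈ 0#
  *-nonzero x≉0 y≉0 xy≈0 = x≉0 (*-cancelʳ y≉0 (trans xy≈0 (sym (zeroˡ _))))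

  ^-nonzero : ∀ {x} n → ¬ x ≈ 0# → ¬ x ^ n ≈ 0#
  ^-nonzero ℕ.zero    x≉0 1≈0 = 0≉1 (sym 1≈0)
  ^-nonzero (ℕ.suc n) x≉0     = *-nonzero x≉0 (^-nonzero n x≉0)

  ∏-nonzero : ∀ {a} {A : Set a} (f : A → Carrier) (xs : List A) → (∀ x → ¬ f x ≈ 0#) → ¬ ∏ (map f xs) ≈ 0#
  ∏-nonzero f []       f≉0 1≈0 = 0≉1 (sym 1≈0)
  ∏-nonzero f (x ∷ xs) f≉0     = *-nonzero (f≉0 x) (∏-nonzero f xs f≉0)

  x≉r⇒x-r≉0 : ∀ {x r} → ¬ x ≈ r → ¬ x - r ≈ 0#
  x≉r⇒x-r≉0 {x} {r} x≉r x-r≈0 = x≉r (begin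
    x              ≈⟨ solve 2 (λ x r → x := (x :- r) :+ r) refl x r ⟩
    (x - r) + r    ≈⟨ +-congʳ x-r≈0 ⟩
    0# + r         ≈⟨ +-identityˡ r ⟩
    r              ∎)

  pow≈^ : ∀ x n → pow F x n ≈ x ^ n
  pow≈^ x ℕ.zero    = refl
  pow≈^ x (ℕ.suc n) = *-congˡ (pow≈^ x n)

  ×1-homo-^ : ∀ p e → (p ℕ.^ e) × 1# ≈ (p × 1#) ^ e
  ×1-homo-^ p ℕ.zero    = +-identityʳ 1#
  ×1-homo-^ p (ℕ.suc e) = trans (×1-homo-* p (p ℕ.^ e)) (*-congˡ (×1-homo-^ p e))

  0^n≈0 : ∀ {n} → 1 ℕ.≤ n → 0# ^ n ≈ 0#
  0^n≈0 {ℕ.suc n} _ = zeroˡ _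

  1^n≈1 : ∀ n → 1# ^ n ≈ 1#
  1^n≈1 ℕ.zero    = refl
  1^n≈1 (ℕ.suc n) = trans (*-identityˡ _) (1^n≈1 n)

  ∏-scaled : ∀ {r} s′ κ w (Λ : Fin (ℕ.suc s′) → Carrier) → ℕ.suc s′ ℕ.≤ r →
    ∏ (map (λ j → κ * (w ^ (r ℕ.∸ 1) * Λ j)) (allFin (ℕ.suc s′)))
      ≈ (κ * w ^ r) ^ s′ * (κ * (w ^ (r ℕ.∸ ℕ.suc s′) * ∏ (map Λ (allFin (ℕ.suc s′)))))
  ∏-scaled {r} s′ κ w Λ s≤r with ℕ.m≤n⇒∃[o]m+o≡n s≤r
  ... | t , ≡.refl = begin
    ∏ (map (λ j → κ * (w ^ (s′ ℕ.+ t) * Λ j)) (allFin s))     ≈⟨ ∏-cong (allFin s) (λ j → *-assoc κ _ (Λ j)) ⟨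
    ∏ (map (λ j → a * Λ j) (allFin s))                        ≈⟨ ∏-* (λ _ → a) Λ (allFin s) ⟩
    ∏ (map (λ _ → a) (allFin s)) * ΠΛ                         ≈⟨ *-congʳ (∏-const a (allFin s)) ⟩
    a ^ length (allFin s) * ΠΛ                                ≡⟨ ≡.cong (λ n → a ^ n * ΠΛ) (List.length-tabulate {n = s} id) ⟩
    a ^ s * ΠΛ                                                ≈⟨ *-congʳ (^-distrib-* κ _ s) ⟩
    (κ * κ ^ s′) * (w ^ (s′ ℕ.+ t)) ^ s * ΠΛ                   ≈⟨ *-congʳ (*-congˡ w-exponents) ⟩
    (κ * κ ^ s′) * ((w ^ r) ^ s′ * w ^ t) * ΠΛ                 ≈⟨ solve 5 (λ k K W V P → (k :* K) :* (W :* V) :* P := (K :* W) :* (k :* (V :* P))) refl κ (κ ^ s′) _ (w ^ t) ΠΛ ⟩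
    (κ ^ s′ * (w ^ r) ^ s′) * (κ * (w ^ t * ΠΛ))               ≈⟨ *-congʳ (^-distrib-* κ (w ^ r) s′) ⟨
    (κ * w ^ r) ^ s′ * (κ * (w ^ t * ΠΛ))                      ≡⟨ ≡.cong (λ n → (κ * w ^ r) ^ s′ * (κ * (w ^ n * ΠΛ))) (ℕ.m+n∸m≡n s′ t) ⟨
    (κ * w ^ r) ^ s′ * (κ * (w ^ (r ℕ.∸ s) * ΠΛ))              ∎
    where
    s = ℕ.suc s′
    a = κ * w ^ (s′ ℕ.+ t)
    ΠΛ = ∏ (map Λ (allFin s))
    w-exponents : (w ^ (s′ ℕ.+ t)) ^ s ≈ (w ^ r) ^ s′ * w ^ t
    w-exponents = begin
      (w ^ (s′ ℕ.+ t)) ^ s        ≈⟨ ^-assocʳ w (s′ ℕ.+ t) s ⟩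
      w ^ ((s′ ℕ.+ t) ℕ.* s)      ≡⟨ ≡.cong (w ^_) ([m+n]*[1+m]≡[1+m+n]*m+n s′ t) ⟩
      w ^ (r ℕ.* s′ ℕ.+ t)        ≈⟨ ^-homo-* w (r ℕ.* s′) t ⟩
      w ^ (r ℕ.* s′) * w ^ t      ≈⟨ *-congʳ (^-assocʳ w r s′) ⟨
      (w ^ r) ^ s′ * w ^ t        ∎

  -- Polynomials as coefficient lists, constant term first.

  eval : List Carrier → Carrier → Carrier
  eval []      x = 0#
  eval (a ∷ p) x = a + x * eval p x

  quotient-by : Carrier → List Carrier → List Carrier
  quotient-by r []          = []
  quotient-by r (a ∷ [])    = []
  quotient-by r (a ∷ b ∷ p) = eval (b ∷ p) r ∷ quotient-by r (b ∷ p)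

  length-quotient-by : ∀ r a p → length (quotient-by r (a ∷ p)) ≡ length p
  length-quotient-by r a []      = ≡.refl
  length-quotient-by r a (b ∷ p) = ≡.cong ℕ.suc (length-quotient-by r b p)

  eval-division : ∀ r p x → eval p x ≈ eval p r + (x - r) * eval (quotient-by r p) x
  eval-division r []          x = sym (trans (+-identityˡ _) (zeroʳ _))
  eval-division r (a ∷ [])    x = begin
    a + x * 0#                        ≈⟨ +-congˡ (zeroʳ x) ⟩
    a + 0#                            ≈⟨ +-congˡ (zeroʳ r) ⟨
    a + r * 0#                        ≈⟨ +-identityʳ _ ⟨
    (a + r * 0#) + 0#                 ≈⟨ +-congˡ (zeroʳ (x - r)) ⟨
    (a + r * 0#) + (x - r) * 0#       ∎
  eval-division r (a ∷ b ∷ p) x = begin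
    a + x * eval (b ∷ p) x
      ≈⟨ +-congˡ (*-congˡ (eval-division r (b ∷ p) x)) ⟩
    a + x * (eval (b ∷ p) r + (x - r) * eval (quotient-by r (b ∷ p)) x)
      ≈⟨ solve 5 (λ a x r e q → a :+ x :* (e :+ (x :- r) :* q) := (a :+ r :* e) :+ (x :- r) :* (e :+ x :* q)) refl a x r _ _ ⟩
    (a + r * eval (b ∷ p) r) + (x - r) * (eval (b ∷ p) r + x * eval (quotient-by r (b ∷ p)) x)
      ∎

  vanishing-on-enough-points : ∀ n (rs : Fin n → Carrier) → (∀ i j → i ≢ j → ¬ rs i ≈ rs j) →
    ∀ p → length p ℕ.≤ n → (∀ i → eval p (rs i) ≈ 0#) → ∀ x → eval p x ≈ 0#
  vanishing-on-enough-points n         rs distinct []      _                 _ x = refl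
  vanishing-on-enough-points (ℕ.suc n) rs distinct (a ∷ p) (ℕ.s≤s |p|≤n) p[rs]≈0 x = begin
    eval (a ∷ p) x                               ≈⟨ eval-division r (a ∷ p) x ⟩
    eval (a ∷ p) r + (x - r) * eval p/[x-r] x    ≈⟨ +-cong (p[rs]≈0 zero) (*-congˡ (p/[x-r]≈0 x)) ⟩
    0# + (x - r) * 0#                            ≈⟨ +-identityˡ _ ⟩
    (x - r) * 0#                                 ≈⟨ zeroʳ _ ⟩
    0#                                           ∎
    where
    r = rs zero
    p/[x-r] = quotient-by r (a ∷ p)
    p/[x-r]-vanishes : ∀ i → eval p/[x-r] (rs (suc i)) ≈ 0#
    p/[x-r]-vanishes i = *-cancelʳ (x≉r⇒x-r≉0 (distinct (suc i) zero λ ())) (begin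
      eval p/[x-r] (rs (suc i)) * (rs (suc i) - r)               ≈⟨ *-comm _ _ ⟩
      (rs (suc i) - r) * eval p/[x-r] (rs (suc i))               ≈⟨ +-identityˡ _ ⟨
      0# + (rs (suc i) - r) * eval p/[x-r] (rs (suc i))          ≈⟨ +-congʳ (p[rs]≈0 zero) ⟨
      eval (a ∷ p) r + (rs (suc i) - r) * eval p/[x-r] (rs (suc i)) ≈⟨ eval-division r (a ∷ p) (rs (suc i)) ⟨
      eval (a ∷ p) (rs (suc i))                                  ≈⟨ p[rs]≈0 (suc i) ⟩
      0#                                                         ≈⟨ zeroˡ _ ⟨
      0# * (rs (suc i) - r)                                      ∎)
    p/[x-r]≈0 : ∀ x → eval p/[x-r] x ≈ 0#
    p/[x-r]≈0 = vanishing-on-enough-points n (rs ∘ suc) (λ i j i≢j → distinct (suc i) (suc j) (i≢j ∘ Fin.suc-injective))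
                  p/[x-r] (≡.subst (ℕ._≤ n) (≡.sym (length-quotient-by r a p)) |p|≤n) p/[x-r]-vanishes

  monomial : ℕ → Carrier → List Carrier
  monomial ℕ.zero    a = a ∷ []
  monomial (ℕ.suc k) a = 0# ∷ monomial k a

  eval-monomial : ∀ k a x → eval (monomial k a) x ≈ x ^ k * a
  eval-monomial ℕ.zero    a x = trans (+-congˡ (zeroʳ x)) (trans (+-identityʳ a) (sym (*-identityˡ a)))
  eval-monomial (ℕ.suc k) a x = trans (+-identityˡ _) (trans (*-congˡ (eval-monomial k a x)) (sym (*-assoc _ _ _)))

  length-monomial : ∀ k a → length (monomial k a) ≡ ℕ.suc k
  length-monomial ℕ.zero    a = ≡.refl
  length-monomial (ℕ.suc k) a = ≡.cong ℕ.suc (length-monomial k a)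

  import Algebra.Properties.CommutativeSemiring.Binomial commutativeSemiring as Binomial
  import Algebra.Properties.Monoid.Sum +-monoid as Sum

  module _ {p} (p-prime : Prime p) (p≈0 : p × 1# ≈ 0#) where
    binomial×≈0 : ∀ {k} x → 0 ℕ.< k → k ℕ.< p → (p C k) × x ≈ 0#
    binomial×≈0 {k} x 0<k k<p = begin
      (p C k) × x                      ≈⟨ Mult.×-congʳ (p C k) (*-identityˡ x) ⟨
      (p C k) × (1# * x)               ≈⟨ ×-assoc-* (p C k) 1# x ⟨
      (p C k) × 1# * x                 ≡⟨ ≡.cong (λ n → n × 1# * x) (m∣n⇒n≡quotient*m p∣pCk) ⟩
      (quotient p∣pCk ℕ.* p) × 1# * x  ≈⟨ *-congʳ (×1-homo-* (quotient p∣pCk) p) ⟩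
      quotient p∣pCk × 1# * p × 1# * x ≈⟨ *-congʳ (*-congˡ p≈0) ⟩
      quotient p∣pCk × 1# * 0# * x     ≈⟨ *-congʳ (zeroʳ _) ⟩
      0# * x                           ≈⟨ zeroˡ x ⟩
      0#                               ∎
      where p∣pCk = prime∣binomial p-prime 0<k k<p

  frobenius : ∀ {p} → Prime p → p × 1# ≈ 0# → ∀ x y → (x + y) ^ p ≈ x ^ p + y ^ p
  frobenius {ℕ.zero}       p-prime _ x y = ⊥-elim (ℕ.<⇒≱ (prime⇒2≤ p-prime) ℕ.z≤n)
  frobenius {ℕ.suc ℕ.zero} p-prime _ x y = ⊥-elim (ℕ.<⇒≱ (prime⇒2≤ p-prime) (ℕ.s≤s ℕ.z≤n))
  frobenius {ℕ.suc (ℕ.suc r)} p-prime p≈0 x y = begin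
    (x + y) ^ p′                                              ≈⟨ Binomial.theorem p′ x y ⟩
    t zero + Sum.sum (t ∘ suc)                                ≈⟨ +-congˡ (Sum.sum-init-last (t ∘ suc)) ⟩
    t zero + (Sum.sum (t ∘ suc ∘ inject₁) + t (suc (fromℕ (ℕ.suc r))))
      ≈⟨ +-cong (trans (+-identityʳ _) (*-identityˡ _)) (+-cong (Sum.sum-cong-≋ middle≈0) last≈x^p) ⟩
    y ^ p′ + (Sum.sum {ℕ.suc r} (λ _ → 0#) + x ^ p′)          ≈⟨ +-congˡ (+-congʳ (Sum.sum-replicate-zero (ℕ.suc r))) ⟩
    y ^ p′ + (0# + x ^ p′)                                    ≈⟨ trans (+-congˡ (+-identityˡ _)) (+-comm _ _) ⟩
    x ^ p′ + y ^ p′                                           ∎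
    where
    p′ = ℕ.suc (ℕ.suc r)
    t = Binomial.binomialTerm x y p′
    middle≈0 : ∀ i → t (suc (inject₁ i)) ≈ 0#
    middle≈0 i = trans (reflexive (≡.cong (λ k → (p′ C k) × (x ^ k * y ^ (p′ ℕ.∸ k))) (≡.cong ℕ.suc (Fin.toℕ-inject₁ i))))
                       (binomial×≈0 p-prime p≈0 _ (ℕ.s≤s ℕ.z≤n) (ℕ.s≤s (Fin.toℕ<n i)))
    last≈x^p : t (suc (fromℕ (ℕ.suc r))) ≈ x ^ p′
    last≈x^p = begin
      t (suc (fromℕ (ℕ.suc r)))               ≡⟨ ≡.cong (λ k → (p′ C k) × (x ^ k * y ^ (p′ ℕ.∸ k))) (≡.cong ℕ.suc (Fin.toℕ-fromℕ (ℕ.suc r))) ⟩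
      (p′ C p′) × (x ^ p′ * y ^ (p′ ℕ.∸ p′))  ≡⟨ ≡.cong₂ (λ n k → n × (x ^ p′ * y ^ k)) (nCn≡1 p′) (ℕ.n∸n≡0 p′) ⟩
      1 × (x ^ p′ * 1#)                       ≈⟨ +-identityʳ _ ⟩
      x ^ p′ * 1#                             ≈⟨ *-identityʳ _ ⟩
      x ^ p′                                  ∎

  frobenius-^ : ∀ {p} → Prime p → p × 1# ≈ 0# → ∀ k x y → (x + y) ^ (p ℕ.^ k) ≈ x ^ (p ℕ.^ k) + y ^ (p ℕ.^ k)
  frobenius-^ p-prime p≈0 ℕ.zero x y = trans (*-identityʳ _) (sym (+-cong (*-identityʳ x) (*-identityʳ y)))
  frobenius-^ {p} p-prime p≈0 (ℕ.suc k) x y = begin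
    (x + y) ^ (p ℕ.* p ℕ.^ k)                  ≈⟨ ^-assocʳ (x + y) p (p ℕ.^ k) ⟨
    ((x + y) ^ p) ^ (p ℕ.^ k)                  ≈⟨ ^-congˡ (p ℕ.^ k) (frobenius p-prime p≈0 x y) ⟩
    (x ^ p + y ^ p) ^ (p ℕ.^ k)                ≈⟨ frobenius-^ p-prime p≈0 k (x ^ p) (y ^ p) ⟩
    (x ^ p) ^ (p ℕ.^ k) + (y ^ p) ^ (p ℕ.^ k)  ≈⟨ +-cong (^-assocʳ x p _) (^-assocʳ y p _) ⟩
    x ^ (p ℕ.* p ℕ.^ k) + y ^ (p ℕ.* p ℕ.^ k)  ∎

module FiniteSubfieldTheory {c ℓ} (F : Field c ℓ) {r} (K : FiniteSubfield F (ℕ.suc r)) where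
  open Field F hiding (zero)
  open FieldTheory F
  open FiniteSubfield K renaming (e to ι)
  open import Relation.Binary.Reasoning.Setoid setoid
  open CommutativeRingSolver commRing

  q : ℕ
  q = ℕ.suc r

  Σₖ : (Fin q → Carrier) → Carrier
  Σₖ f = ∑ (map f (allFin q))

  0ₖ 1ₖ : Fin q
  0ₖ = proj₁ has-0
  1ₖ = proj₁ has-1

  ι0ₖ≈0 : ι 0ₖ ≈ 0#
  ι0ₖ≈0 = proj₂ has-0

  ι1ₖ≈1 : ι 1ₖ ≈ 1#
  ι1ₖ≈1 = proj₂ has-1

  ι≉0 : ∀ {a} → a ≢ 0ₖ → ¬ ι a ≈ 0#
  ι≉0 {a} a≢0ₖ ιa≈0 = a≢0ₖ (e-inj a 0ₖ (trans ιa≈0 (sym ι0ₖ≈0)))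

  ι≈0⊎ι≉0 : ∀ a → ι a ≈ 0# ⊎ ¬ ι a ≈ 0#
  ι≈0⊎ι≉0 a with a Fin.≟ 0ₖ
  ... | yes ≡.refl = inj₁ ι0ₖ≈0
  ... | no a≢0ₖ    = inj₂ (ι≉0 a≢0ₖ)

  1≤r : 1 ℕ.≤ r
  1≤r = two-elements 0ₖ 1ₖ λ 0ₖ≡1ₖ → 0≉1 (trans (sym ι0ₖ≈0) (trans (reflexive (≡.cong ι 0ₖ≡1ₖ)) ι1ₖ≈1))
    where
    two-elements : ∀ {n} (a b : Fin (ℕ.suc n)) → a ≢ b → 1 ℕ.≤ n
    two-elements {ℕ.zero}  zero zero a≢b = contradiction ≡.refl a≢b
    two-elements {ℕ.suc n} _    _    _   = ℕ.s≤s ℕ.z≤n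

  nonzero : Fin r → Fin q
  nonzero = punchIn 0ₖ

  nonzero≢0ₖ : ∀ i → nonzero i ≢ 0ₖ
  nonzero≢0ₖ = Fin.punchInᵢ≢i 0ₖ

  module Reindex (σ τ : Fin q → Fin q) (στ : ∀ a → ι (σ (τ a)) ≈ ι a) (τσ : ∀ a → ι (τ (σ a)) ≈ ι a) where

    Σₖ-reindex : ∀ f → Σₖ (f ∘ σ) ≈ Σₖ f
    Σₖ-reindex = ∑-permute σ τ (λ a → e-inj _ _ (στ a)) (λ a → e-inj _ _ (τσ a))

    Πₖ-reindex : ∀ f → ∏ (map (f ∘ σ) (allFin q)) ≈ ∏ (map f (allFin q))
    Πₖ-reindex = ∏-permute σ τ (λ a → e-inj _ _ (στ a)) (λ a → e-inj _ _ (τσ a))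

  translate : Fin q → Fin q → Fin q
  translate c a = proj₁ (+-cl a c)

  ι-translate : ∀ c a → ι (translate c a) ≈ ι a + ι c
  ι-translate c a = proj₂ (+-cl a c)

  module _ (c : Fin q) where
    private
      -c = proj₁ (neg-cl c)

      translate-cancel : ∀ d e a → ι d + ι e ≈ 0# → ι (translate d (translate e a)) ≈ ι a
      translate-cancel d e a d+e≈0 = begin
        ι (translate d (translate e a))  ≈⟨ trans (ι-translate d _) (+-congʳ (ι-translate e a)) ⟩
        (ι a + ι e) + ι d                ≈⟨ solve 3 (λ x y z → (x :+ y) :+ z := x :+ (z :+ y)) refl _ _ _ ⟩
        ι a + (ι d + ι e)                ≈⟨ +-congˡ d+e≈0 ⟩
        ι a + 0#                         ≈⟨ +-identityʳ _ ⟩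
        ι a                              ∎

    open Reindex (translate c) (translate -c)
      (λ a → translate-cancel c -c a (trans (+-congˡ (proj₂ (neg-cl c))) (-‿inverseʳ _)))
      (λ a → translate-cancel -c c a (trans (+-congʳ (proj₂ (neg-cl c))) (-‿inverseˡ _)))
      public using () renaming (Σₖ-reindex to Σₖ-translate)

  Σₖ1≈0 : Σₖ (λ _ → 1#) ≈ 0#
  Σₖ1≈0 = identityʳ-unique (Σₖ ι) _ (begin
    Σₖ ι + Σₖ (λ _ → 1#)          ≈⟨ ∑-+ ι (λ _ → 1#) (allFin q) ⟨
    Σₖ (λ a → ι a + 1#)           ≈⟨ ∑-cong (allFin q) (λ a → trans (ι-translate 1ₖ a) (+-congˡ ι1ₖ≈1)) ⟨
    Σₖ (ι ∘ translate 1ₖ)         ≈⟨ Σₖ-translate 1ₖ ι ⟩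
    Σₖ ι                          ∎)
    where open import Algebra.Properties.AbelianGroup +-abelianGroup using (identityʳ-unique)

  scale : Fin q → Fin q → Fin q
  scale c a = proj₁ (*-cl c a)

  ι-scale : ∀ c a → ι (scale c a) ≈ ι c * ι a
  ι-scale c a = proj₂ (*-cl c a)

  module _ {c : Fin q} (ιc≉0 : ¬ ι c ≈ 0#) where
    private
      c⁻¹ = proj₁ (inv-cl c ιc≉0)

      scale-cancel : ∀ d e a → ι d * ι e ≈ 1# → ι (scale d (scale e a)) ≈ ι a
      scale-cancel d e a de≈1 = begin
        ι (scale d (scale e a))  ≈⟨ trans (ι-scale d _) (*-congˡ (ι-scale e a)) ⟩
        ι d * (ι e * ι a)        ≈⟨ *-assoc _ _ _ ⟨
        (ι d * ι e) * ι a        ≈⟨ *-congʳ de≈1 ⟩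
        1# * ι a                 ≈⟨ *-identityˡ _ ⟩
        ι a                      ∎

    open Reindex (scale c) (scale c⁻¹)
      (λ a → scale-cancel c c⁻¹ a (trans (*-congˡ (proj₂ (inv-cl c ιc≉0))) (inv-r _ ιc≉0)))
      (λ a → scale-cancel c⁻¹ c a (trans (*-comm _ _) (trans (*-congˡ (proj₂ (inv-cl c ιc≉0))) (inv-r _ ιc≉0))))
      public using () renaming (Σₖ-reindex to Σₖ-scale; Πₖ-reindex to Πₖ-scale)

  -- Scaling by c permutes K and fixes 0ₖ, so it multiplies the product of the
  -- elements of K, with 0 replaced by 1, by c^r.
  private
    replace-0ₖ : Carrier → Fin q → Carrier
    replace-0ₖ x a with a Fin.≟ 0ₖ
    ... | yes _ = 1#
    ... | no  _ = x

    replace-0ₖ-0ₖ : ∀ x {a} → a ≡ 0ₖ → replace-0ₖ x a ≈ 1#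
    replace-0ₖ-0ₖ x {a} a≡0ₖ with a Fin.≟ 0ₖ
    ... | yes _    = refl
    ... | no a≢0ₖ  = contradiction a≡0ₖ a≢0ₖ

    replace-0ₖ-≢ : ∀ x {a} → a ≢ 0ₖ → replace-0ₖ x a ≈ x
    replace-0ₖ-≢ x {a} a≢0ₖ with a Fin.≟ 0ₖ
    ... | yes a≡0ₖ = contradiction a≡0ₖ a≢0ₖ
    ... | no _     = refl

  fermat : ∀ {c} → ¬ ι c ≈ 0# → ι c ^ r ≈ 1#
  fermat {c} ιc≉0 = *-cancelʳ (∏-nonzero ι̂ (allFin q) ι̂≉0) (begin
    ι c ^ r * ∏ (map ι̂ (allFin q))                        ≈⟨ *-congʳ ∏ĉ≈ιc^r ⟨
    ∏ (map ĉ (allFin q)) * ∏ (map ι̂ (allFin q))           ≈⟨ ∏-* ĉ ι̂ (allFin q) ⟨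
    ∏ (map (λ a → ĉ a * ι̂ a) (allFin q))                  ≈⟨ ∏-cong (allFin q) ι̂-scale ⟨
    ∏ (map (ι̂ ∘ scale c) (allFin q))                      ≈⟨ Πₖ-scale ιc≉0 ι̂ ⟩
    ∏ (map ι̂ (allFin q))                                  ≈⟨ *-identityˡ _ ⟨
    1# * ∏ (map ι̂ (allFin q))                             ∎)
    where
    ι̂ ĉ : Fin q → Carrier
    ι̂ a = replace-0ₖ (ι a) a
    ĉ   = replace-0ₖ (ι c)

    ι̂≉0 : ∀ a → ¬ ι̂ a ≈ 0#
    ι̂≉0 a with a Fin.≟ 0ₖ
    ... | yes _   = λ 1≈0 → 0≉1 (sym 1≈0)
    ... | no a≢0ₖ = ι≉0 a≢0ₖ

    scale-0ₖ : scale c 0ₖ ≡ 0ₖ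
    scale-0ₖ = e-inj _ _ (trans (ι-scale c 0ₖ) (trans (*-congˡ ι0ₖ≈0) (trans (zeroʳ _) (sym ι0ₖ≈0))))

    ι̂-scale : ∀ a → ι̂ (scale c a) ≈ ĉ a * ι̂ a
    ι̂-scale a with a Fin.≟ 0ₖ
    ... | yes ≡.refl = trans (replace-0ₖ-0ₖ _ scale-0ₖ) (sym (*-identityˡ 1#))
    ... | no a≢0ₖ    = begin
      ι̂ (scale c a)   ≈⟨ replace-0ₖ-≢ _ ca≢0ₖ ⟩
      ι (scale c a)   ≈⟨ ι-scale c a ⟩
      ι c * ι a       ∎
      where
      ca≢0ₖ : scale c a ≢ 0ₖ
      ca≢0ₖ ca≡0ₖ = *-nonzero ιc≉0 (ι≉0 a≢0ₖ) (trans (sym (ι-scale c a)) (trans (reflexive (≡.cong ι ca≡0ₖ)) ι0ₖ≈0))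

    ∏ĉ≈ιc^r : ∏ (map ĉ (allFin q)) ≈ ι c ^ r
    ∏ĉ≈ιc^r = begin
      ∏ (map ĉ (allFin q))                          ≈⟨ ∏-remove 0ₖ ĉ ⟩
      ĉ 0ₖ * ∏ (map (ĉ ∘ nonzero) (allFin r))       ≈⟨ *-cong (replace-0ₖ-0ₖ _ ≡.refl) (∏-cong (allFin r) (replace-0ₖ-≢ _ ∘ nonzero≢0ₖ)) ⟩
      1# * ∏ (map (λ _ → ι c) (allFin r))           ≈⟨ *-identityˡ _ ⟩
      ∏ (map (λ _ → ι c) (allFin r))                ≈⟨ ∏-const (ι c) (allFin r) ⟩
      ι c ^ length (allFin r)                       ≡⟨ ≡.cong (ι c ^_) (List.length-tabulate {n = r} id) ⟩
      ι c ^ r                                       ∎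

  ι^q≈ι : ∀ a → ι a ^ q ≈ ι a
  ι^q≈ι a with ι≈0⊎ι≉0 a
  ... | inj₁ ιa≈0 = trans (*-congʳ ιa≈0) (trans (zeroˡ _) (sym ιa≈0))
  ... | inj₂ ιa≉0 = trans (*-congˡ (fermat ιa≉0)) (*-identityʳ _)

  -- Scaling shows c^k P = P for c ≠ 0, so P (x^k − 1) has the r nonzero elements
  -- of K as roots but only k + 1 ≤ r coefficients.
  power-sum : ∀ k → k ℕ.< r → Σₖ (λ a → ι a ^ k) ≈ 0#
  power-sum ℕ.zero      _   = Σₖ1≈0
  power-sum (ℕ.suc k-1) k<r = begin
    P                                        ≈⟨ -‿involutive P ⟨
    - - P                                    ≈⟨ -‿cong (trans (+-congˡ (zeroˡ _)) (+-identityʳ _)) ⟨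
    - (- P + 0# * eval (monomial k-1 P) 0#)  ≈⟨ -‿cong (vanishing-on-enough-points r (ι ∘ nonzero) distinct p |p|≤r p[nonzero]≈0 0#) ⟩
    - 0#                                     ≈⟨ -0#≈0# ⟩
    0#                                       ∎
    where
    open import Algebra.Properties.Ring ring using (-0#≈0#; -‿involutive)
    k = ℕ.suc k-1
    P = Σₖ (λ a → ι a ^ k)
    p = - P ∷ monomial k-1 P

    distinct : ∀ i j → i ≢ j → ¬ ι (nonzero i) ≈ ι (nonzero j)
    distinct i j i≢j ιi≈ιj = i≢j (Fin.punchIn-injective 0ₖ i j (e-inj _ _ ιi≈ιj))

    |p|≤r : length p ℕ.≤ r
    |p|≤r = ≡.subst (ℕ._≤ r) (≡.sym (≡.cong ℕ.suc (length-monomial k-1 P))) k<r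

    scale-invariant : ∀ {c} → ¬ ι c ≈ 0# → ι c ^ k * P ≈ P
    scale-invariant {c} ιc≉0 = begin
      ι c ^ k * P                              ≈⟨ ∑-*ˡ (ι c ^ k) (λ a → ι a ^ k) (allFin q) ⟨
      Σₖ (λ a → ι c ^ k * ι a ^ k)             ≈⟨ ∑-cong (allFin q) (λ a → trans (sym (^-distrib-* _ _ k)) (^-congˡ k (sym (ι-scale c a)))) ⟩
      Σₖ (λ a → ι (scale c a) ^ k)             ≈⟨ Σₖ-scale ιc≉0 (λ a → ι a ^ k) ⟩
      P                                        ∎

    p[nonzero]≈0 : ∀ i → eval p (ι (nonzero i)) ≈ 0#
    p[nonzero]≈0 i = begin
      - P + x * eval (monomial k-1 P) x        ≈⟨ +-congˡ (*-congˡ (eval-monomial k-1 P x)) ⟩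
      - P + x * (x ^ k-1 * P)                  ≈⟨ +-congˡ (*-assoc _ _ _) ⟨
      - P + x ^ k * P                          ≈⟨ +-congˡ (scale-invariant (ι≉0 (nonzero≢0ₖ i))) ⟩
      - P + P                                  ≈⟨ -‿inverseˡ P ⟩
      0#                                       ∎
      where x = ι (nonzero i)

  q×1≈0 : q × 1# ≈ 0#
  q×1≈0 = begin
    q × 1#                      ≡⟨ ≡.cong (_× 1#) (List.length-tabulate {n = q} id) ⟨
    length (allFin q) × 1#      ≈⟨ ∑-const 1# (allFin q) ⟨
    Σₖ (λ _ → 1#)               ≈⟨ Σₖ1≈0 ⟩
    0#                          ∎

  module _ (q-primePower : IsPrimePower q) where
    private
      p = proj₁ q-primePower
      e = proj₁ (proj₂ q-primePower)
      p-prime = proj₁ (proj₂ (proj₂ q-primePower))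
      q≡p^e = proj₂ (proj₂ (proj₂ (proj₂ q-primePower)))

      ×1-in-K : ∀ n → ∃ λ a → ι a ≈ n × 1#
      ×1-in-K ℕ.zero    = 0ₖ , ι0ₖ≈0
      ×1-in-K (ℕ.suc n) with ×1-in-K n
      ... | a , ιa≈n×1 = proj₁ (+-cl 1ₖ a) , trans (proj₂ (+-cl 1ₖ a)) (+-cong ι1ₖ≈1 ιa≈n×1)

    -- p × 1# lies in K, where being 0# is decidable; were it not 0#, neither
    -- would be (p × 1#) ^ e = q × 1#.
    characteristic : p × 1# ≈ 0#
    characteristic with ×1-in-K p
    ... | a , ιa≈p with ι≈0⊎ι≉0 a
    ...   | inj₁ ιa≈0 = trans (sym ιa≈p) ιa≈0
    ...   | inj₂ ιa≉0 = contradiction p^e≈0 (^-nonzero e ιa≉0)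
      where
      p^e≈0 : ι a ^ e ≈ 0#
      p^e≈0 = begin
        ι a ^ e          ≈⟨ ^-congˡ e ιa≈p ⟩
        (p × 1#) ^ e     ≈⟨ ×1-homo-^ p e ⟨
        (p ℕ.^ e) × 1#   ≡⟨ ≡.cong (_× 1#) q≡p^e ⟨
        q × 1#           ≈⟨ q×1≈0 ⟩
        0#               ∎

    frobenius-q : ∀ x y → (x + y) ^ q ≈ x ^ q + y ^ q
    frobenius-q x y = begin
      (x + y) ^ q                      ≡⟨ ≡.cong ((x + y) ^_) q≡p^e ⟩
      (x + y) ^ (p ℕ.^ e)              ≈⟨ frobenius-^ p-prime characteristic e x y ⟩
      x ^ (p ℕ.^ e) + y ^ (p ℕ.^ e)    ≡⟨ ≡.cong (λ n → x ^ n + y ^ n) q≡p^e ⟨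
      x ^ q + y ^ q                    ∎

    frobenius-∑ : ∀ {a} {A : Set a} (f : A → Carrier) xs → ∑ (map f xs) ^ q ≈ ∑ (map (λ x → f x ^ q) xs)
    frobenius-∑ f []       = 0^n≈0 {q} (ℕ.s≤s ℕ.z≤n)
    frobenius-∑ f (x ∷ xs) = trans (frobenius-q _ _) (+-congˡ (frobenius-∑ f xs))

module Line {c ℓ} (F : Field c ℓ) {r} (K : FiniteSubfield F (ℕ.suc r)) where
  open Field F hiding (zero)
  open FieldTheory F hiding (_×_)
  open FiniteSubfieldTheory F K
  open FiniteSubfield K using () renaming (e to ι)
  open import Data.Product using (_×_)
  open import Relation.Binary.Reasoning.Setoid setoid
  open CommutativeRingSolver commRing
  open import Algebra.Properties.Ring ring using (-‿distribˡ-*; -‿involutive; -0#≈0#)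

  Π-affine : List (Carrier × Carrier) → Carrier → Carrier
  Π-affine ls t = ∏ (map (λ { (α , γ) → α + t * γ }) ls)

  power-sum-affine : ∀ ls k → k ℕ.+ length ls ℕ.< r → Σₖ (λ a → ι a ^ k * Π-affine ls (ι a)) ≈ 0#
  power-sum-affine []            k k<r = trans (∑-cong (allFin q) (λ a → *-identityʳ _)) (power-sum k (≡.subst (ℕ._< r) (ℕ.+-identityʳ k) k<r))
  power-sum-affine ((α , γ) ∷ ls) k k+|ls|<r = begin
    Σₖ (λ a → ι a ^ k * ((α + ι a * γ) * Π-affine ls (ι a)))
      ≈⟨ ∑-cong (allFin q) (λ a → solve 5 (λ x t α γ P → x :* ((α :+ t :* γ) :* P) := α :* (x :* P) :+ γ :* ((t :* x) :* P)) refl (ι a ^ k) (ι a) α γ _) ⟩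
    Σₖ (λ a → α * (ι a ^ k * Π-affine ls (ι a)) + γ * (ι a ^ ℕ.suc k * Π-affine ls (ι a)))
      ≈⟨ ∑-+ _ _ (allFin q) ⟩
    Σₖ (λ a → α * (ι a ^ k * Π-affine ls (ι a))) + Σₖ (λ a → γ * (ι a ^ ℕ.suc k * Π-affine ls (ι a)))
      ≈⟨ +-cong (∑-*ˡ α _ (allFin q)) (∑-*ˡ γ _ (allFin q)) ⟩
    α * Σₖ (λ a → ι a ^ k * Π-affine ls (ι a)) + γ * Σₖ (λ a → ι a ^ ℕ.suc k * Π-affine ls (ι a))
      ≈⟨ +-cong (*-congˡ (power-sum-affine ls k (ℕ.<-trans (ℕ.+-monoʳ-< k (ℕ.n<1+n _)) k+|ls|<r)))
                (*-congˡ (power-sum-affine ls (ℕ.suc k) (≡.subst (ℕ._< r) (ℕ.+-suc k (length ls)) k+|ls|<r))) ⟩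
    α * 0# + γ * 0#
      ≈⟨ trans (+-cong (zeroʳ α) (zeroʳ γ)) (+-identityʳ 0#) ⟩
    0# ∎

  module _ (m β : Carrier) (den≉0 : ∀ a → ¬ m + ι a * β ≈ 0#) where

    D⁻¹ : Fin q → Carrier
    D⁻¹ a = inv (m + ι a * β) (den≉0 a)

    φ : (Carrier → Carrier) → Carrier
    φ g = Σₖ (λ a → g (ι a) * D⁻¹ a)

    m≉0 : ¬ m ≈ 0#
    m≉0 m≈0 = den≉0 0ₖ (trans (+-cong m≈0 (trans (*-congʳ ι0ₖ≈0) (zeroˡ β))) (+-identityʳ 0#))

    m⁻¹ : Carrier
    m⁻¹ = inv m m≉0

    -- norm = ∏_{a ∈ K} (m + ι a * β), but only this closed form is used.
    norm : Carrier
    norm = m ^ q - m * (- β) ^ r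

    φ-shift : ∀ g → m * φ g ≈ Σₖ (g ∘ ι) - β * φ (λ t → t * g t)
    φ-shift g = begin
      m * φ g                                          ≈⟨ ∑-*ˡ m _ (allFin q) ⟨
      Σₖ (λ a → m * (g (ι a) * D⁻¹ a))                 ≈⟨ ∑-cong (allFin q) term ⟩
      Σₖ (λ a → g (ι a) + - (β * (ι a * g (ι a) * D⁻¹ a))) ≈⟨ ∑-+ (g ∘ ι) _ (allFin q) ⟩
      Σₖ (g ∘ ι) + Σₖ (λ a → - (β * (ι a * g (ι a) * D⁻¹ a))) ≈⟨ +-congˡ (∑-neg _ (allFin q)) ⟩
      Σₖ (g ∘ ι) - Σₖ (λ a → β * (ι a * g (ι a) * D⁻¹ a))    ≈⟨ +-congˡ (-‿cong (∑-*ˡ β _ (allFin q))) ⟩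
      Σₖ (g ∘ ι) - β * φ (λ t → t * g t)                     ∎
      where
      term : ∀ a → m * (g (ι a) * D⁻¹ a) ≈ g (ι a) + - (β * (ι a * g (ι a) * D⁻¹ a))
      term a = begin
        m * (g (ι a) * D⁻¹ a)
          ≈⟨ solve 5 (λ m y d t b → m :* (y :* d) := y :* ((m :+ t :* b) :* d) :+ (:- (b :* (t :* y :* d)))) refl m (g (ι a)) (D⁻¹ a) (ι a) β ⟩
        g (ι a) * ((m + ι a * β) * D⁻¹ a) + - (β * (ι a * g (ι a) * D⁻¹ a))
          ≈⟨ +-congʳ (trans (*-congˡ (inv-r _ (den≉0 a))) (*-identityʳ _)) ⟩
        g (ι a) + - (β * (ι a * g (ι a) * D⁻¹ a))
          ∎

    φ-step : ∀ k → k ℕ.< r → m * φ (_^ k) ≈ (- β) * φ (_^ ℕ.suc k)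
    φ-step k k<r = begin
      m * φ (_^ k)                          ≈⟨ φ-shift (_^ k) ⟩
      Σₖ (λ a → ι a ^ k) - β * φ (_^ ℕ.suc k)  ≈⟨ +-congʳ (power-sum k k<r) ⟩
      0# - β * φ (_^ ℕ.suc k)               ≈⟨ +-identityˡ _ ⟩
      - (β * φ (_^ ℕ.suc k))                ≈⟨ -‿distribˡ-* β _ ⟩
      (- β) * φ (_^ ℕ.suc k)                ∎

    φ-descend : ∀ j k → j ℕ.+ k ≡ r → m ^ j * φ (_^ k) ≈ (- β) ^ j * φ (_^ r)
    φ-descend ℕ.zero    k ≡.refl = refl
    φ-descend (ℕ.suc j) k j+k≡r  = begin
      (m * m ^ j) * φ (_^ k)              ≈⟨ solve 3 (λ a b c → (a :* b) :* c := b :* (a :* c)) refl m (m ^ j) _ ⟩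
      m ^ j * (m * φ (_^ k))              ≈⟨ *-congˡ (φ-step k k<r) ⟩
      m ^ j * ((- β) * φ (_^ ℕ.suc k))    ≈⟨ solve 3 (λ a b c → a :* (b :* c) := b :* (a :* c)) refl (m ^ j) (- β) _ ⟩
      (- β) * (m ^ j * φ (_^ ℕ.suc k))    ≈⟨ *-congˡ (φ-descend j (ℕ.suc k) (≡.trans (ℕ.+-suc j k) j+k≡r)) ⟩
      (- β) * ((- β) ^ j * φ (_^ r))      ≈⟨ *-assoc _ _ _ ⟨
      (- β) ^ ℕ.suc j * φ (_^ r)          ∎
      where
      k<r : k ℕ.< r
      k<r = ≡.subst (k ℕ.<_) j+k≡r (ℕ.m<n+m k (ℕ.s≤s ℕ.z≤n))

    D⁻¹0ₖ≈m⁻¹ : D⁻¹ 0ₖ ≈ m⁻¹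
    D⁻¹0ₖ≈m⁻¹ = inv-cong _ _ (trans (+-congˡ (trans (*-congʳ ι0ₖ≈0) (zeroˡ β))) (+-identityʳ m))

    φ1≈φ[^r]+m⁻¹ : φ (_^ 0) ≈ φ (_^ r) + m⁻¹
    φ1≈φ[^r]+m⁻¹ = begin
      φ (_^ 0)                                              ≈⟨ ∑-remove 0ₖ _ ⟩
      1# * D⁻¹ 0ₖ + Σ′ (λ _ → 1#)                           ≈⟨ +-cong (trans (*-identityˡ _) D⁻¹0ₖ≈m⁻¹) (∑-cong (allFin r) (λ i → *-congʳ (sym (fermat (ι≉0 (nonzero≢0ₖ i)))))) ⟩
      m⁻¹ + Σ′ (_^ r)                                       ≈⟨ +-comm _ _ ⟩
      Σ′ (_^ r) + m⁻¹                                       ≈⟨ +-congʳ (+-identityˡ _) ⟨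
      (0# + Σ′ (_^ r)) + m⁻¹                                ≈⟨ +-congʳ (+-congʳ (trans (*-congʳ (trans (^-congˡ r ι0ₖ≈0) (0^n≈0 1≤r))) (zeroˡ _))) ⟨
      (ι 0ₖ ^ r * D⁻¹ 0ₖ + Σ′ (_^ r)) + m⁻¹                 ≈⟨ +-congʳ (∑-remove 0ₖ _) ⟨
      φ (_^ r) + m⁻¹                                        ∎
      where
      Σ′ : (Carrier → Carrier) → Carrier
      Σ′ g = ∑ (map (λ i → g (ι (nonzero i)) * D⁻¹ (nonzero i)) (allFin r))

    φ[^r]*norm≈-m^r : φ (_^ r) * norm ≈ - m ^ r
    φ[^r]*norm≈-m^r = begin
      Y * (m * M - m * B)             ≈⟨ solve 4 (λ y m M B → y :* (m :* M :- m :* B) := m :* (M :* y) :- m :* (B :* y)) refl Y m M B ⟩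
      m * (M * Y) - m * (B * Y)       ≈⟨ +-congˡ (-‿cong (*-congˡ (trans (sym (φ-descend r 0 (ℕ.+-identityʳ r))) (*-congˡ φ1≈φ[^r]+m⁻¹)))) ⟩
      m * (M * Y) - m * (M * (Y + m⁻¹)) ≈⟨ solve 4 (λ m M y i → m :* (M :* y) :- m :* (M :* (y :+ i)) := :- (M :* (m :* i))) refl m M Y m⁻¹ ⟩
      - (M * (m * m⁻¹))               ≈⟨ -‿cong (trans (*-congˡ (inv-r m m≉0)) (*-identityʳ M)) ⟩
      - M                             ∎
      where
      Y = φ (_^ r)
      M = m ^ r
      B = (- β) ^ r

    norm≉0 : ¬ norm ≈ 0#
    norm≉0 norm≈0 = ^-nonzero r m≉0 (begin
      m ^ r                 ≈⟨ -‿involutive _ ⟨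
      - - m ^ r             ≈⟨ -‿cong φ[^r]*norm≈-m^r ⟨
      - (φ (_^ r) * norm)      ≈⟨ -‿cong (trans (*-congˡ norm≈0) (zeroʳ _)) ⟩
      - 0#                  ≈⟨ -0#≈0# ⟩
      0#                    ∎)

    φ-monomial : ∀ k → k ℕ.≤ r → φ (_^ k) * norm ≈ - ((- β) ^ (r ℕ.∸ k) * m ^ k)
    φ-monomial k k≤r = *-cancelʳ (^-nonzero j m≉0) (begin
      (φ (_^ k) * norm) * m ^ j           ≈⟨ solve 3 (λ a b c → (a :* b) :* c := (c :* a) :* b) refl _ norm (m ^ j) ⟩
      (m ^ j * φ (_^ k)) * norm           ≈⟨ *-congʳ (φ-descend j k (ℕ.m∸n+n≡m k≤r)) ⟩
      ((- β) ^ j * φ (_^ r)) * norm       ≈⟨ *-assoc _ _ _ ⟩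
      (- β) ^ j * (φ (_^ r) * norm)       ≈⟨ *-congˡ φ[^r]*norm≈-m^r ⟩
      (- β) ^ j * - m ^ r              ≈⟨ *-congˡ (-‿cong (trans (reflexive (≡.cong (m ^_) (≡.sym (ℕ.m∸n+n≡m k≤r)))) (^-homo-* m j k))) ⟩
      (- β) ^ j * - (m ^ j * m ^ k)    ≈⟨ solve 3 (λ b x y → b :* (:- (x :* y)) := (:- (b :* y)) :* x) refl _ (m ^ j) (m ^ k) ⟩
      - ((- β) ^ j * m ^ k) * m ^ j    ∎)
      where j = r ℕ.∸ k

    Π-homogenised : List (Carrier × Carrier) → Carrier
    Π-homogenised ls = ∏ (map (λ { (α , γ) → γ * m - α * β }) ls)

    -- The right side is minus the degree-r homogenisation of t ^ k * Π-affine ls t,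
    -- evaluated at (m , - β).
    φ-affine : ∀ ls k → k ℕ.+ length ls ℕ.≤ r →
               φ (λ t → t ^ k * Π-affine ls t) * norm ≈ - ((- β) ^ (r ℕ.∸ (k ℕ.+ length ls)) * m ^ k * Π-homogenised ls)
    φ-affine [] k k≤r = begin
      φ (λ t → t ^ k * 1#) * norm                      ≈⟨ *-congʳ (∑-cong (allFin q) (λ a → *-congʳ (*-identityʳ _))) ⟩
      φ (_^ k) * norm                                  ≈⟨ φ-monomial k k≤r′ ⟩
      - ((- β) ^ (r ℕ.∸ k) * m ^ k)                 ≈⟨ -‿cong (*-identityʳ _) ⟨
      - ((- β) ^ (r ℕ.∸ k) * m ^ k * 1#)            ≡⟨ ≡.cong (λ n → - ((- β) ^ (r ℕ.∸ n) * m ^ k * 1#)) (ℕ.+-identityʳ k) ⟨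
      - ((- β) ^ (r ℕ.∸ (k ℕ.+ 0)) * m ^ k * 1#)    ∎
      where k≤r′ = ≡.subst (ℕ._≤ r) (ℕ.+-identityʳ k) k≤r
    φ-affine ((α , γ) ∷ ls) k k+|l∷ls|≤r = *-cancelʳ m≉0 (begin
      φ g * norm * m                                   ≈⟨ solve 3 (λ a b c → a :* b :* c := (c :* a) :* b) refl (φ g) norm m ⟩
      (m * φ g) * norm                                 ≈⟨ *-congʳ m*φg≈ ⟩
      (α * Σₖ h + δ * φ g′) * norm                     ≈⟨ *-congʳ (+-congʳ (trans (*-congˡ (power-sum-affine ls k k+|ls|<r)) (zeroʳ α))) ⟩
      (0# + δ * φ g′) * norm                           ≈⟨ trans (*-congʳ (+-identityˡ _)) (*-assoc _ _ _) ⟩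
      δ * (φ g′ * norm)                                ≈⟨ *-congˡ (φ-affine ls (ℕ.suc k) k+|ls|<r) ⟩
      δ * - ((- β) ^ e * m ^ ℕ.suc k * Π-homogenised ls)
        ≈⟨ solve 5 (λ d b m x P → d :* (:- (b :* (m :* x) :* P)) := (:- (b :* x :* (d :* P))) :* m) refl δ ((- β) ^ e) m (m ^ k) _ ⟩
      - ((- β) ^ e * m ^ k * (δ * Π-homogenised ls)) * m
        ≡⟨ ≡.cong (λ n → - ((- β) ^ (r ℕ.∸ n) * m ^ k * (δ * Π-homogenised ls)) * m) (ℕ.+-suc k (length ls)) ⟨
      - ((- β) ^ (r ℕ.∸ (k ℕ.+ ℕ.suc (length ls))) * m ^ k * (δ * Π-homogenised ls)) * m ∎)
      where
      δ = γ * m - α * β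
      e = r ℕ.∸ (ℕ.suc k ℕ.+ length ls)
      g g′ : Carrier → Carrier
      g t = t ^ k * ((α + t * γ) * Π-affine ls t)
      g′ t = t ^ ℕ.suc k * Π-affine ls t
      h = λ a → ι a ^ k * Π-affine ls (ι a)
      k+|ls|<r : k ℕ.+ length ls ℕ.< r
      k+|ls|<r = ≡.subst (ℕ._≤ r) (ℕ.+-suc k (length ls)) k+|l∷ls|≤r
      term : ∀ a → m * (g (ι a) * D⁻¹ a) ≈ α * h a + δ * (g′ (ι a) * D⁻¹ a)
      term a = begin
        m * (x * ((α + t * γ) * P) * D⁻¹ a)
          ≈⟨ solve 8 (λ m x t α γ P i β → m :* (x :* ((α :+ t :* γ) :* P) :* i) := α :* (x :* P) :* ((m :+ t :* β) :* i) :+ (γ :* m :- α :* β) :* ((t :* x :* P) :* i)) refl m x t α γ P (D⁻¹ a) β ⟩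
        α * (x * P) * ((m + t * β) * D⁻¹ a) + δ * ((t * x * P) * D⁻¹ a)
          ≈⟨ +-congʳ (trans (*-congˡ (inv-r _ (den≉0 a))) (*-identityʳ _)) ⟩
        α * (x * P) + δ * ((t * x * P) * D⁻¹ a)
          ∎
        where
        t = ι a
        x = ι a ^ k
        P = Π-affine ls (ι a)
      m*φg≈ : m * φ g ≈ α * Σₖ h + δ * φ g′
      m*φg≈ = begin
        m * φ g                                         ≈⟨ ∑-*ˡ m _ (allFin q) ⟨
        Σₖ (λ a → m * (g (ι a) * D⁻¹ a))                ≈⟨ ∑-cong (allFin q) term ⟩
        Σₖ (λ a → α * h a + δ * (g′ (ι a) * D⁻¹ a))     ≈⟨ ∑-+ _ _ (allFin q) ⟩
        Σₖ (λ a → α * h a) + Σₖ (λ a → δ * (g′ (ι a) * D⁻¹ a)) ≈⟨ +-cong (∑-*ˡ α h (allFin q)) (∑-*ˡ δ _ (allFin q)) ⟩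
        α * Σₖ h + δ * φ g′                             ∎

    φ-Π-affine : ∀ ls → length ls ℕ.≤ r → φ (Π-affine ls) ≈ - ((- β) ^ (r ℕ.∸ length ls) * Π-homogenised ls) * inv norm norm≉0
    φ-Π-affine ls |ls|≤r = *≈⇒≈*inv norm≉0 (begin
      φ (Π-affine ls) * norm                                   ≈⟨ *-congʳ (∑-cong (allFin q) (λ a → *-congʳ (*-identityˡ _))) ⟨
      φ (λ t → t ^ 0 * Π-affine ls t) * norm                   ≈⟨ φ-affine ls 0 |ls|≤r ⟩
      - ((- β) ^ (r ℕ.∸ length ls) * 1# * Π-homogenised ls) ≈⟨ -‿cong (*-congʳ (*-identityʳ _)) ⟩
      - ((- β) ^ (r ℕ.∸ length ls) * Π-homogenised ls)      ∎)

module Space {c ℓ} (F : Field c ℓ) {r} (K : FiniteSubfield F (ℕ.suc r)) (q-primePower : IsPrimePower (ℕ.suc r)) where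
  open Field F hiding (zero)
  open FieldTheory F hiding (_×_)
  open FiniteSubfieldTheory F K
  open Line F K
  open FiniteSubfield K using () renaming (e to ι)
  open import Data.Product using (_×_)
  open import Relation.Binary.Reasoning.Setoid setoid
  open CommutativeRingSolver commRing

  Affine : ℕ → Set c
  Affine d = Carrier × (Fin d → Carrier)

  _⟨_⟩ : ∀ {d} → Affine d → Vec (Fin q) d → Carrier
  _⟨_⟩ {d} (α , γ) θ = α + ∑ (map (λ i → ι (lookup θ i) * γ i) (allFin d))

  eval-at : ∀ {d} → Carrier → (Fin d → Carrier) → Affine d → Carrier
  eval-at {d} w u (α , γ) = α * w + ∑ (map (λ i → u i * γ i) (allFin d))

  ⟨⟩≈eval-at : ∀ {d} (L : Affine d) θ → L ⟨ θ ⟩ ≈ eval-at 1# (ι ∘ lookup θ) L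
  ⟨⟩≈eval-at L θ = +-congʳ (sym (*-identityʳ _))

  coeff₀ : ∀ {d} → Affine (ℕ.suc d) → Carrier
  coeff₀ (_ , γ) = γ zero

  rest : ∀ {d} → Affine (ℕ.suc d) → Affine d
  rest (α , γ) = α , γ ∘ suc

  lincomb : ∀ {d} → Carrier → Affine d → Carrier → Affine d → Affine d
  lincomb x (α , γ) y (α′ , γ′) = x * α - α′ * y , λ i → x * γ i - γ′ i * y

  frobenius-affine : ∀ {d} → Affine d → Affine d
  frobenius-affine (α , γ) = α ^ q , λ i → γ i ^ q

  eval-at-cons : ∀ {d} w u (L : Affine (ℕ.suc d)) → eval-at w u L ≈ eval-at w (u ∘ suc) (rest L) + u zero * coeff₀ L
  eval-at-cons {d} w u (α , γ) = begin
    α * w + ∑ (map (λ i → u i * γ i) (allFin (ℕ.suc d)))  ≡⟨ ≡.cong (λ xs → α * w + ∑ xs) (map-allFin-suc (λ i → u i * γ i)) ⟩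
    α * w + (u zero * γ zero + s)                         ≈⟨ solve 3 (λ a x s → a :+ (x :+ s) := (a :+ s) :+ x) refl (α * w) _ s ⟩
    (α * w + s) + u zero * γ zero                         ∎
    where s = ∑ (map (λ i → u (suc i) * γ (suc i)) (allFin d))

  eval-at-scale : ∀ {d} y w u (L : Affine d) → eval-at (y * w) (λ i → y * u i) L ≈ y * eval-at w u L
  eval-at-scale {d} y w u (α , γ) = begin
    α * (y * w) + ∑ (map (λ i → (y * u i) * γ i) (allFin d))   ≈⟨ +-cong (solve 3 (λ a y w → a :* (y :* w) := y :* (a :* w)) refl α y w)
                                                                         (∑-cong (allFin d) (λ i → *-assoc y (u i) (γ i))) ⟩
    y * (α * w) + ∑ (map (λ i → y * (u i * γ i)) (allFin d))   ≈⟨ +-congˡ (∑-*ˡ y _ (allFin d)) ⟩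
    y * (α * w) + y * ∑ (map (λ i → u i * γ i) (allFin d))     ≈⟨ distribˡ y _ _ ⟨
    y * (α * w + ∑ (map (λ i → u i * γ i) (allFin d)))         ∎

  eval-at-lincomb : ∀ {d} w u x (L : Affine d) y L′ → eval-at w u (lincomb x L y L′) ≈ x * eval-at w u L - eval-at w u L′ * y
  eval-at-lincomb {d} w u x (α , γ) y (α′ , γ′) = begin
    (x * α - α′ * y) * w + ∑ (map (λ i → u i * (x * γ i - γ′ i * y)) (allFin d))
      ≈⟨ +-congˡ (∑-cong (allFin d) (λ i → solve 5 (λ v g g′ x y → v :* (x :* g :- g′ :* y) := x :* (v :* g) :+ :- (y :* (v :* g′))) refl (u i) (γ i) (γ′ i) x y)) ⟩
    (x * α - α′ * y) * w + ∑ (map (λ i → x * (u i * γ i) + - (y * (u i * γ′ i))) (allFin d))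
      ≈⟨ +-congˡ (trans (∑-+ _ _ (allFin d)) (+-cong (∑-*ˡ x _ (allFin d)) (trans (∑-neg _ (allFin d)) (-‿cong (∑-*ˡ y _ (allFin d)))))) ⟩
    (x * α - α′ * y) * w + (x * S + - (y * S′))
      ≈⟨ solve 7 (λ x α α′ w S S′ y → (x :* α :- α′ :* y) :* w :+ (x :* S :+ :- (y :* S′)) := x :* (α :* w :+ S) :- (α′ :* w :+ S′) :* y) refl x α α′ w S S′ y ⟩
    x * (α * w + S) - (α′ * w + S′) * y
      ∎
    where
    S  = ∑ (map (λ i → u i * γ i) (allFin d))
    S′ = ∑ (map (λ i → u i * γ′ i) (allFin d))

  ⟨∷⟩ : ∀ {d} (L : Affine (ℕ.suc d)) a θ → L ⟨ a ∷ θ ⟩ ≈ rest L ⟨ θ ⟩ + ι a * coeff₀ L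
  ⟨∷⟩ L a θ = trans (⟨⟩≈eval-at L (a ∷ θ)) (trans (eval-at-cons _ _ L) (+-congʳ (sym (⟨⟩≈eval-at (rest L) θ))))

  ∑-allVecs-suc : ∀ {d} (f : Vec (Fin q) (ℕ.suc d) → Carrier) →
                  ∑ (map f (allVecs q (ℕ.suc d))) ≈ ∑ (map (λ θ → Σₖ (λ a → f (a ∷ θ))) (allVecs q d))
  ∑-allVecs-suc {d} f = begin
    ∑ (map f (concatMap (λ a → map (a ∷_) (allVecs q d)) (allFin q)))  ≈⟨ ∑-concatMap f (λ a → map (a ∷_) (allVecs q d)) (allFin q) ⟩
    Σₖ (λ a → ∑ (map f (map (a ∷_) (allVecs q d))))                    ≡⟨ ≡.cong ∑ (List.map-cong (λ a → ≡.cong ∑ (≡.sym (List.map-∘ (allVecs q d)))) (allFin q)) ⟩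
    Σₖ (λ a → ∑ (map (λ θ → f (a ∷ θ)) (allVecs q d)))                 ≈⟨ ∑-comm (λ a θ → f (a ∷ θ)) (allFin q) (allVecs q d) ⟩
    ∑ (map (λ θ → Σₖ (λ a → f (a ∷ θ))) (allVecs q d))                 ∎

  ⟨lincomb⟩ : ∀ {d} x (L : Affine d) y L′ θ → lincomb x L y L′ ⟨ θ ⟩ ≈ x * L ⟨ θ ⟩ - L′ ⟨ θ ⟩ * y
  ⟨lincomb⟩ x L y L′ θ = begin
    lincomb x L y L′ ⟨ θ ⟩                                          ≈⟨ ⟨⟩≈eval-at (lincomb x L y L′) θ ⟩
    eval-at 1# (ι ∘ lookup θ) (lincomb x L y L′)                   ≈⟨ eval-at-lincomb _ _ x L y L′ ⟩
    x * eval-at 1# (ι ∘ lookup θ) L - eval-at 1# (ι ∘ lookup θ) L′ * y ≈⟨ +-cong (*-congˡ (⟨⟩≈eval-at L θ)) (-‿cong (*-congʳ (⟨⟩≈eval-at L′ θ))) ⟨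
    x * L ⟨ θ ⟩ - L′ ⟨ θ ⟩ * y                                     ∎

  ⟨frobenius-affine⟩ : ∀ {d} (L : Affine d) θ → frobenius-affine L ⟨ θ ⟩ ≈ L ⟨ θ ⟩ ^ q
  ⟨frobenius-affine⟩ {d} (α , γ) θ = sym (begin
    (α + ∑ (map (λ i → ι (lookup θ i) * γ i) (allFin d))) ^ q    ≈⟨ frobenius-q q-primePower _ _ ⟩
    α ^ q + ∑ (map (λ i → ι (lookup θ i) * γ i) (allFin d)) ^ q  ≈⟨ +-congˡ (frobenius-∑ q-primePower _ (allFin d)) ⟩
    α ^ q + ∑ (map (λ i → (ι (lookup θ i) * γ i) ^ q) (allFin d)) ≈⟨ +-congˡ (∑-cong (allFin d) (λ i → trans (^-distrib-* _ _ q) (*-congʳ (ι^q≈ι _)))) ⟩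
    α ^ q + ∑ (map (λ i → ι (lookup θ i) * γ i ^ q) (allFin d))  ∎)

  weighted-sum : ∀ {d} (den : Affine d) → (∀ θ → ¬ den ⟨ θ ⟩ ≈ 0#) → List (Affine d) → Carrier
  weighted-sum {d} den den≉0 Ls = ∑ (map (λ θ → ∏ (map (_⟨ θ ⟩) Ls) * inv (den ⟨ θ ⟩) (den≉0 θ)) (allVecs q d))

  record Factorisation {d} (den : Affine d) (den≉0 : ∀ θ → ¬ den ⟨ θ ⟩ ≈ 0#) : Set (c ⊔ ℓ) where
    field
      κ w : Carrier
      u   : Fin d → Carrier
      weighted-sum≈ : ∀ Ls → length Ls ℕ.≤ r →
                    weighted-sum den den≉0 Ls ≈ κ * (w ^ (r ∸ length Ls) * ∏ (map (eval-at w u) Ls))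

  module Elimination {d} (den : Affine (ℕ.suc d)) (den≉0 : ∀ θ → ¬ den ⟨ θ ⟩ ≈ 0#) where

    β : Carrier
    β = coeff₀ den

    line≉0 : ∀ θ a → ¬ rest den ⟨ θ ⟩ + ι a * β ≈ 0#
    line≉0 θ a = den≉0 (a ∷ θ) ∘ trans (⟨∷⟩ den a θ)

    eliminate : Affine (ℕ.suc d) → Affine d
    eliminate L = lincomb (coeff₀ L) (rest den) β (rest L)

    -- den′ ⟨ θ ⟩ is the norm of the line a ↦ den ⟨ a ∷ θ ⟩.
    den′ : Affine d
    den′ = lincomb 1# (frobenius-affine (rest den)) ((- β) ^ r) (rest den)

    norm≈den′ : ∀ θ → norm (rest den ⟨ θ ⟩) β (line≉0 θ) ≈ den′ ⟨ θ ⟩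
    norm≈den′ θ = sym (begin
      den′ ⟨ θ ⟩                                                   ≈⟨ ⟨lincomb⟩ 1# _ _ (rest den) θ ⟩
      1# * frobenius-affine (rest den) ⟨ θ ⟩ - rest den ⟨ θ ⟩ * (- β) ^ r ≈⟨ +-congʳ (trans (*-identityˡ _) (⟨frobenius-affine⟩ (rest den) θ)) ⟩
      rest den ⟨ θ ⟩ ^ q - rest den ⟨ θ ⟩ * (- β) ^ r               ∎)

    den′≉0 : ∀ θ → ¬ den′ ⟨ θ ⟩ ≈ 0#
    den′≉0 θ = norm≉0 _ β (line≉0 θ) ∘ trans (norm≈den′ θ)

    sum-first-coordinate : ∀ Ls → length Ls ℕ.≤ r → ∀ θ →
      Σₖ (λ a → ∏ (map (_⟨ a ∷ θ ⟩) Ls) * inv (den ⟨ a ∷ θ ⟩) (den≉0 (a ∷ θ)))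
        ≈ - ((- β) ^ (r ∸ length Ls)) * (∏ (map (_⟨ θ ⟩) (map eliminate Ls)) * inv (den′ ⟨ θ ⟩) (den′≉0 θ))
    sum-first-coordinate Ls |Ls|≤r θ = begin
      Σₖ (λ a → ∏ (map (_⟨ a ∷ θ ⟩) Ls) * inv (den ⟨ a ∷ θ ⟩) (den≉0 (a ∷ θ)))
        ≈⟨ ∑-cong (allFin q) (λ a → *-cong (Π-cons a) (inv-cong _ _ (⟨∷⟩ den a θ))) ⟩
      φ m β (line≉0 θ) (Π-affine pairs)
        ≈⟨ φ-Π-affine m β (line≉0 θ) pairs |pairs|≤r ⟩
      - ((- β) ^ (r ∸ length pairs) * Π-homogenised m β (line≉0 θ) pairs) * inv (norm m β (line≉0 θ)) (norm≉0 m β (line≉0 θ))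
        ≈⟨ *-cong (-‿cong (*-cong (reflexive (≡.cong (λ n → (- β) ^ (r ∸ n)) (List.length-map _ Ls))) Π-eliminate)) (inv-cong _ _ (norm≈den′ θ)) ⟩
      - ((- β) ^ (r ∸ length Ls) * ∏ (map (_⟨ θ ⟩) (map eliminate Ls))) * inv (den′ ⟨ θ ⟩) (den′≉0 θ)
        ≈⟨ solve 3 (λ b p i → (:- (b :* p)) :* i := (:- b) :* (p :* i)) refl _ _ _ ⟩
      - ((- β) ^ (r ∸ length Ls)) * (∏ (map (_⟨ θ ⟩) (map eliminate Ls)) * inv (den′ ⟨ θ ⟩) (den′≉0 θ))
        ∎
      where
      m = rest den ⟨ θ ⟩
      pairs = map (λ L → rest L ⟨ θ ⟩ , coeff₀ L) Ls
      |pairs|≤r = ≡.subst (ℕ._≤ r) (≡.sym (List.length-map _ Ls)) |Ls|≤r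
      Π-cons : ∀ a → ∏ (map (_⟨ a ∷ θ ⟩) Ls) ≈ Π-affine pairs (ι a)
      Π-cons a = begin
        ∏ (map (_⟨ a ∷ θ ⟩) Ls)                                  ≈⟨ ∏-cong Ls (λ L → ⟨∷⟩ L a θ) ⟩
        ∏ (map (λ L → rest L ⟨ θ ⟩ + ι a * coeff₀ L) Ls)         ≡⟨ ≡.cong ∏ (List.map-∘ Ls) ⟩
        Π-affine pairs (ι a)                                     ∎
      Π-eliminate : Π-homogenised m β (line≉0 θ) pairs ≈ ∏ (map (_⟨ θ ⟩) (map eliminate Ls))
      Π-eliminate = begin
        Π-homogenised m β (line≉0 θ) pairs                         ≡⟨ ≡.cong ∏ (List.map-∘ Ls) ⟨
        ∏ (map (λ L → coeff₀ L * m - rest L ⟨ θ ⟩ * β) Ls)          ≈⟨ ∏-cong Ls (λ L → sym (⟨lincomb⟩ (coeff₀ L) (rest den) β (rest L) θ)) ⟩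
        ∏ (map (λ L → eliminate L ⟨ θ ⟩) Ls)                        ≡⟨ ≡.cong ∏ (List.map-∘ Ls) ⟩
        ∏ (map (_⟨ θ ⟩) (map eliminate Ls))                        ∎

    weighted-sum-eliminate : ∀ Ls → length Ls ℕ.≤ r →
      weighted-sum den den≉0 Ls ≈ - ((- β) ^ (r ∸ length Ls)) * weighted-sum den′ den′≉0 (map eliminate Ls)
    weighted-sum-eliminate Ls |Ls|≤r = begin
      weighted-sum den den≉0 Ls                                        ≈⟨ ∑-allVecs-suc {d} (λ θ → ∏ (map (_⟨ θ ⟩) Ls) * inv (den ⟨ θ ⟩) (den≉0 θ)) ⟩
      ∑ (map (λ θ → Σₖ (λ a → ∏ (map (_⟨ a ∷ θ ⟩) Ls) * inv (den ⟨ a ∷ θ ⟩) (den≉0 (a ∷ θ)))) (allVecs q d)) ≈⟨ ∑-cong (allVecs q d) (sum-first-coordinate Ls |Ls|≤r) ⟩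
      ∑ (map (λ θ → - ((- β) ^ (r ∸ length Ls)) * _) (allVecs q d))  ≈⟨ ∑-*ˡ _ _ (allVecs q d) ⟩
      - ((- β) ^ (r ∸ length Ls)) * weighted-sum den′ den′≉0 (map eliminate Ls) ∎

    extend : Carrier → (Fin d → Carrier) → Fin (ℕ.suc d) → Carrier
    extend w u zero    = eval-at w u (rest den)
    extend w u (suc i) = (- β) * u i

    eval-at-eliminate : ∀ w u L → eval-at w u (eliminate L) ≈ eval-at ((- β) * w) (extend w u) L
    eval-at-eliminate w u L = begin
      eval-at w u (eliminate L)                                        ≈⟨ eval-at-lincomb w u (coeff₀ L) (rest den) β (rest L) ⟩
      coeff₀ L * eval-at w u (rest den) - eval-at w u (rest L) * β    ≈⟨ solve 4 (λ g e f b → g :* e :- f :* b := (:- b) :* f :+ e :* g) refl _ _ _ β ⟩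
      (- β) * eval-at w u (rest L) + eval-at w u (rest den) * coeff₀ L ≈⟨ +-congʳ (eval-at-scale (- β) w u (rest L)) ⟨
      eval-at ((- β) * w) (λ i → (- β) * u i) (rest L) + eval-at w u (rest den) * coeff₀ L ≈⟨ eval-at-cons _ (extend w u) L ⟨
      eval-at ((- β) * w) (extend w u) L                               ∎

  factorisation : ∀ d (den : Affine d) den≉0 → Factorisation den den≉0
  factorisation ℕ.zero den den≉0 = record { κ = κ ; w = 1# ; u = λ () ; weighted-sum≈ = factorises }
    where
    κ = inv (den ⟨ [] ⟩) (den≉0 [])

    factorises : ∀ Ls → length Ls ℕ.≤ r → weighted-sum den den≉0 Ls ≈ κ * (1# ^ (r ∸ length Ls) * ∏ (map (eval-at 1# (λ ())) Ls))
    factorises Ls _ = begin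
      ∏ (map (_⟨ [] ⟩) Ls) * κ + 0#                               ≈⟨ trans (+-identityʳ _) (*-comm _ _) ⟩
      κ * ∏ (map (_⟨ [] ⟩) Ls)                                    ≈⟨ *-congˡ (∏-cong Ls (λ L → +-congʳ (sym (*-identityʳ _)))) ⟩
      κ * ∏ (map (eval-at 1# (λ ())) Ls)                          ≈⟨ *-congˡ (trans (*-congʳ (1^n≈1 (r ∸ length Ls))) (*-identityˡ _)) ⟨
      κ * (1# ^ (r ∸ length Ls) * ∏ (map (eval-at 1# (λ ())) Ls)) ∎

  factorisation (ℕ.suc d) den den≉0 = record { κ = - κ′ ; w = (- β) * w′ ; u = extend w′ u′ ; weighted-sum≈ = factorises }
    where
    open Elimination den den≉0
    open Factorisation (factorisation d den′ den′≉0) renaming (κ to κ′; w to w′; u to u′; weighted-sum≈ to weighted-sum≈′)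

    factorises : ∀ Ls → length Ls ℕ.≤ r →
      weighted-sum den den≉0 Ls ≈ - κ′ * (((- β) * w′) ^ (r ∸ length Ls) * ∏ (map (eval-at ((- β) * w′) (extend w′ u′)) Ls))
    factorises Ls |Ls|≤r = begin
      weighted-sum den den≉0 Ls
        ≈⟨ weighted-sum-eliminate Ls |Ls|≤r ⟩
      - ((- β) ^ e) * weighted-sum den′ den′≉0 (map eliminate Ls)
        ≈⟨ *-congˡ (weighted-sum≈′ (map eliminate Ls) (≡.subst (ℕ._≤ r) (≡.sym (List.length-map eliminate Ls)) |Ls|≤r)) ⟩
      - ((- β) ^ e) * (κ′ * (w′ ^ (r ∸ length (map eliminate Ls)) * ∏ (map (eval-at w′ u′) (map eliminate Ls))))
        ≡⟨ ≡.cong₂ (λ n P → - ((- β) ^ e) * (κ′ * (w′ ^ (r ∸ n) * ∏ P))) (List.length-map eliminate Ls) (≡.sym (List.map-∘ Ls)) ⟩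
      - ((- β) ^ e) * (κ′ * (w′ ^ e * ∏ (map (eval-at w′ u′ ∘ eliminate) Ls)))
        ≈⟨ *-congˡ (*-congˡ (*-congˡ (∏-cong Ls (eval-at-eliminate w′ u′)))) ⟩
      - ((- β) ^ e) * (κ′ * (w′ ^ e * Π))
        ≈⟨ solve 4 (λ b k x P → (:- b) :* (k :* (x :* P)) := (:- k) :* ((b :* x) :* P)) refl _ κ′ _ Π ⟩
      - κ′ * (((- β) ^ e * w′ ^ e) * Π)
        ≈⟨ *-congˡ (*-congʳ (^-distrib-* (- β) w′ e)) ⟨
      - κ′ * (((- β) * w′) ^ e * Π)
        ∎
      where
      e = r ∸ length Ls
      Π = ∏ (map (eval-at ((- β) * w′) (extend w′ u′)) Ls)

  ∏-weighted-sum : ∀ {d} (den : Affine d) den≉0 s′ (L : Fin (ℕ.suc s′) → Affine d) → ℕ.suc s′ ℕ.≤ r →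
    ∏ (map (λ j → weighted-sum den den≉0 (L j ∷ [])) (allFin (ℕ.suc s′)))
      ≈ weighted-sum den den≉0 [] ^ s′ * weighted-sum den den≉0 (map L (allFin (ℕ.suc s′)))
  ∏-weighted-sum {d} den den≉0 s′ L s≤r = begin
    ∏ (map (λ j → weighted-sum den den≉0 (L j ∷ [])) (allFin s))          ≈⟨ ∏-cong (allFin s) single ⟩
    ∏ (map (λ j → κ * (w ^ (r ∸ 1) * Λ j)) (allFin s))                  ≈⟨ ∏-scaled s′ κ w Λ s≤r ⟩
    (κ * w ^ r) ^ s′ * (κ * (w ^ (r ∸ s) * ∏ (map Λ (allFin s))))       ≈⟨ *-cong (^-congˡ s′ empty) all ⟨
    weighted-sum den den≉0 [] ^ s′ * weighted-sum den den≉0 (map L (allFin s)) ∎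
    where
    open Factorisation (factorisation d den den≉0)
    s = ℕ.suc s′
    Λ = eval-at w u ∘ L
    single : ∀ j → weighted-sum den den≉0 (L j ∷ []) ≈ κ * (w ^ (r ∸ 1) * Λ j)
    single j = trans (weighted-sum≈ (L j ∷ []) (ℕ.≤-trans (ℕ.s≤s ℕ.z≤n) s≤r)) (*-congˡ (*-congˡ (*-identityʳ _)))
    empty : weighted-sum den den≉0 [] ≈ κ * w ^ r
    empty = trans (weighted-sum≈ [] ℕ.z≤n) (*-congˡ (*-identityʳ _))
    all : weighted-sum den den≉0 (map L (allFin s)) ≈ κ * (w ^ (r ∸ s) * ∏ (map Λ (allFin s)))
    all = begin
      weighted-sum den den≉0 (map L (allFin s))
        ≈⟨ weighted-sum≈ (map L (allFin s)) (≡.subst (ℕ._≤ r) (≡.sym |L|≡s) s≤r) ⟩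
      κ * (w ^ (r ∸ length (map L (allFin s))) * ∏ (map (eval-at w u) (map L (allFin s))))
        ≡⟨ ≡.cong₂ (λ n P → κ * (w ^ (r ∸ n) * ∏ P)) |L|≡s (≡.sym (List.map-∘ (allFin s))) ⟩
      κ * (w ^ (r ∸ s) * ∏ (map Λ (allFin s)))
        ∎
      where
      |L|≡s : length (map L (allFin s)) ≡ s
      |L|≡s = ≡.trans (List.length-map L (allFin s)) (List.length-tabulate {n = s} id)

theorem5 : ∀ {c ℓ} (F : Field c ℓ) (q : ℕ) → IsPrimePower q → (K : FiniteSubfield F q)
    → (d s : ℕ) → d ≥ 1 → s ≥ 1 → s < q
    → (μ : Field.Carrier F) (b : Fin d → Field.Carrier F)
    → (M : Fin s → Field.Carrier F) (B : Fin d → Fin s → Field.Carrier F)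
    → let open Field F
          ι = FiniteSubfield.e K
          den : Vec (Fin q) d → Carrier
          den θ = μ + ΣL F (map (λ i → ι (lookup θ i) * b i) (allFin d))
          num : Fin s → Vec (Fin q) d → Carrier
          num j θ = M j + ΣL F (map (λ i → ι (lookup θ i) * B i j) (allFin d))
      in (h : ∀ θ → ¬ (den θ ≈ 0#))
    → ΠL F (map (λ j → ΣL F (map (λ θ → num j θ * inv (den θ) (h θ)) (allVecs q d))) (allFin s))
      ≈ pow F (ΣL F (map (λ θ → inv (den θ) (h θ)) (allVecs q d))) (s ∸ 1)
        * ΣL F (map (λ θ → ΠL F (map (λ j → num j θ) (allFin s)) * inv (den θ) (h θ)) (allVecs q d))
theorem5 F (ℕ.suc r) q-primePower K d (ℕ.suc s′) _ _ (ℕ.s≤s s≤r) μ b M B h = begin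
  ∏ (map (λ j → ∑ (map (λ θ → L j ⟨ θ ⟩ * inv (den ⟨ θ ⟩) (h θ)) (allVecs q d))) (allFin s))
    ≈⟨ ∏-cong (allFin s) (λ j → ∑-cong (allVecs q d) (λ θ → *-congʳ (sym (*-identityʳ _)))) ⟩
  ∏ (map (λ j → weighted-sum den h (L j ∷ [])) (allFin s))
    ≈⟨ ∏-weighted-sum den h s′ L s≤r ⟩
  weighted-sum den h [] ^ s′ * weighted-sum den h (map L (allFin s))
    ≈⟨ *-cong (trans (^-congˡ s′ (∑-cong (allVecs q d) (λ θ → *-identityˡ _))) (sym (pow≈^ _ s′)))
              (reflexive (≡.cong ∑ (List.map-cong (λ θ → ≡.cong (λ P → ∏ P * inv (den ⟨ θ ⟩) (h θ)) (≡.sym (List.map-∘ (allFin s)))) (allVecs q d)))) ⟩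
  pow F (∑ (map (λ θ → inv (den ⟨ θ ⟩) (h θ)) (allVecs q d))) s′
    * ∑ (map (λ θ → ∏ (map (λ j → L j ⟨ θ ⟩) (allFin s)) * inv (den ⟨ θ ⟩) (h θ)) (allVecs q d))
    ∎
  where
  open Field F hiding (zero)
  open FieldTheory F hiding (_×_)
  open FiniteSubfieldTheory F K using (q)
  open Space F K q-primePower
  open import Relation.Binary.Reasoning.Setoid setoid
  s = ℕ.suc s′
  den : Affine d
  den = μ , b
  L : Fin s → Affine d
  L j = M j , λ i → B i j
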